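{- Let $A\subset\mathbb{N}$. If $A$ admits a Buck density, then $A$ has an asymptotic density $d(A)$ and $$\underline{d}(A+A)\ge\sqrt{d(A)\,\overline{d}(A+A)}.$$
   Context: $\mathbb{N}=\{0,1,2,\dots\}$; $A+A$ is the sumset. For $X\subset\mathbb{N}$, $\overline{d}(X)=\limsup_{n\to\infty}|X\cap[1,n]|/n$ and $\underline{d}(X)=\liminf_{n\to\infty}|X\cap[1,n]|/n$ are the upper and lower asymptotic densities, and $d(X)$ is their common value when they coincide. Let $\mathcal{Z}$ be the family of all finite unions $\bigcup_{i=1}^r(a_i+k_i\mathbb{N})$ with $r,a_i,k_i\in\mathbb{N}$. Upper Buck density: $\overline{\mu}(X)=\inf\{d(B):X\subset B\in\mathcal{Z}\}$; lower Buck density: $\underline{\mu}(X)=\sup\{d(B):X\supset B\in\mathcal{Z}\}$; $X$ admits a Buck density if these coincide. -}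

module Defs where

open import Data.Nat using (ℕ; zero; suc; _≤_; _∸_) renaming (_+_ to _+ℕ_; _*_ to _*ℕ_)
open import Data.Bool using (Bool; true; false; if_then_else_; _∧_)
open import Data.List using (List; upTo)
open import Data.Bool.ListAction using (any)
open import Data.List.Relation.Unary.Any using (Any)
open import Data.Product using (Σ; ∃; _×_; _,_)
open import Data.Integer using (+_)
open import Data.Rational using (ℚ; _/_; _<_; _+_; _-_; ∣_∣; 0ℚ)
open import Relation.Binary.PropositionalEquality using (_≡_)

Subset : Set
Subset = ℕ → Bool

_∈_ : ℕ → Subset → Set
n ∈ X = X n ≡ true

_⊆_ : Subset → Subset → Set
X ⊆ Y = ∀ n → n ∈ X → n ∈ Y

sumset : Subset → Subset
sumset A n = any (λ i → A i ∧ A (n ∸ i)) (upTo (suc n))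

count : Subset → ℕ → ℕ
count X zero = 0
count X (suc n) = count X n +ℕ (if X (suc n) then 1 else 0)

ratio : Subset → ℕ → ℚ
ratio X n = (+ count X (suc n)) / suc n

HasDensityℚ : Subset → ℚ → Set
HasDensityℚ X q = ∀ (ε : ℚ) → 0ℚ < ε → ∃ λ N → ∀ n → N ≤ n → ∣ ratio X n - q ∣ < ε

-- X has an asymptotic density: the sequence |X∩[1,n]|/n converges in ℝ,
-- i.e. is Cauchy.
HasAsymptoticDensity : Subset → Set
HasAsymptoticDensity X = ∀ (ε : ℚ) → 0ℚ < ε →
  ∃ λ N → ∀ m n → N ≤ m → N ≤ n → ∣ ratio X m - ratio X n ∣ < ε

InAP : ℕ → ℕ × ℕ → Set
InAP n (a , k) = ∃ λ m → n ≡ a +ℕ k *ℕ m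

InZ : Subset → Set
InZ X = Σ (List (ℕ × ℕ)) λ ps → ∀ n → (n ∈ X → Any (InAP n) ps) × (Any (InAP n) ps → n ∈ X)

-- X admits a Buck density: upper Buck density = lower Buck density, i.e.
-- for every ε > 0 there are B₁ ⊆ X ⊆ B₂ in 𝒵 with d(B₂) - d(B₁) < ε.
AdmitsBuckDensity : Subset → Set
AdmitsBuckDensity X = ∀ (ε : ℚ) → 0ℚ < ε →
  Σ Subset λ B₁ → Σ Subset λ B₂ → Σ ℚ λ q₁ → Σ ℚ λ q₂ →
    InZ B₁ × InZ B₂ × HasDensityℚ B₁ q₁ × HasDensityℚ B₂ q₂ ×
    B₁ ⊆ X × X ⊆ B₂ × (q₂ - q₁ < ε)

-- Comparisons of a rational with the (real) lower/upper densities.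
-- a < d̲(X)  :⇔  ∃ ε > 0, eventually a + ε < |X∩[1,n]|/n
_<lowerDensity_ : ℚ → Subset → Set
a <lowerDensity X = Σ ℚ λ ε → 0ℚ < ε × (∃ λ N → ∀ n → N ≤ n → a + ε < ratio X n)

_<upperDensity_ : ℚ → Subset → Set
a <upperDensity X = Σ ℚ λ ε → 0ℚ < ε × (∀ N → ∃ λ n → N ≤ n × a + ε < ratio X n)

_lowerDensity<_ : Subset → ℚ → Set
X lowerDensity< b = Σ ℚ λ ε → 0ℚ < ε × (∀ N → ∃ λ n → N ≤ n × ratio X n + ε < b)

{-# OPTIONS --safe #-}

-- Buck density lets us squeeze A between sets B₁ ⊆ A ⊆ B₂ of 𝒵 whose densities are arbitrarily
-- close; this makes the density ratios of A Cauchy. For the inequality, B₁ is, beyond some T, a union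
-- of residue classes R modulo some M, and |R|/M is at least a. Let Y be the set of residues met by A.
-- Then A + A lies in the classes Y + Y, and from some point on contains the classes R + Y, so
-- d̄(A + A) ≤ |Y + Y|/M and |R + Y|/M ≤ d̲(A + A). Ruzsa's inequality |R| |Y + Y| ≤ |R + Y|² in ℤ/Mℤ,
-- proved with Petridis' lemma, finishes the proof. Both Y and the ratio-minimising subset in Petridis'
-- argument are classical choices; they are made under a double negation, which the decidable
-- conclusion absorbs.

module Submission where

open import Data.Nat using (ℕ; suc; NonZero)
open import Defs using (Subset)
open import Relation.Nullary using (Dec)

module FiniteSums where

  open import Data.Bool using (Bool; true; false; if_then_else_)
  open import Data.Nat
  open import Data.Nat.Properties
  open import Data.Nat.DivMod
  open import Data.Product using (∃; _×_; _,_)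
  open import Algebra.Properties.CommutativeSemigroup +-commutativeSemigroup using (interchange)
  open import Data.Sum using (inj₁; inj₂)
  open import Function using (_∘_)
  open import Relation.Binary.PropositionalEquality
  open ≡-Reasoning

  𝟙 : Bool → ℕ
  𝟙 b = if b then 1 else 0

  𝟙≤1 : ∀ b → 𝟙 b ≤ 1
  𝟙≤1 true  = ≤-refl
  𝟙≤1 false = z≤n

  𝟙-mono : ∀ {b c} → (b ≡ true → c ≡ true) → 𝟙 b ≤ 𝟙 c
  𝟙-mono {false} _   = z≤n
  𝟙-mono {true}  b⇒c rewrite b⇒c refl = ≤-refl

  ∑< : ℕ → (ℕ → ℕ) → ℕ
  ∑< zero    f = 0
  ∑< (suc k) f = ∑< k f + f k

  syntax ∑< k (λ i → e) = ∑[ i < k ] e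

  ∑-cong : ∀ k {f g : ℕ → ℕ} → (∀ {i} → i < k → f i ≡ g i) → ∑< k f ≡ ∑< k g
  ∑-cong zero    f≡g = refl
  ∑-cong (suc k) f≡g = cong₂ _+_ (∑-cong k (f≡g ∘ m<n⇒m<1+n)) (f≡g ≤-refl)

  ∑-mono-≤ : ∀ k {f g : ℕ → ℕ} → (∀ {i} → i < k → f i ≤ g i) → ∑< k f ≤ ∑< k g
  ∑-mono-≤ zero    f≤g = z≤n
  ∑-mono-≤ (suc k) f≤g = +-mono-≤ (∑-mono-≤ k (f≤g ∘ m<n⇒m<1+n)) (f≤g ≤-refl)

  ∑-mono-< : ∀ k {f g : ℕ → ℕ} → (∀ {i} → i < k → f i ≤ g i) →
             ∀ {j} → j < k → f j < g j → ∑< k f < ∑< k g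
  ∑-mono-< (suc k) f≤g j<1+k fj<gj with m<1+n⇒m<n∨m≡n j<1+k
  ... | inj₁ j<k  = +-mono-<-≤ (∑-mono-< k (f≤g ∘ m<n⇒m<1+n) j<k fj<gj) (f≤g ≤-refl)
  ... | inj₂ refl = +-mono-≤-< (∑-mono-≤ k (f≤g ∘ m<n⇒m<1+n)) fj<gj

  ∑-distrib-+ : ∀ k (f g : ℕ → ℕ) → ∑[ i < k ] (f i + g i) ≡ ∑< k f + ∑< k g
  ∑-distrib-+ zero    f g = refl
  ∑-distrib-+ (suc k) f g rewrite ∑-distrib-+ k f g = interchange (∑< k f) (∑< k g) (f k) (g k)

  ∑-const : ∀ k c → ∑[ i < k ] c ≡ k * c
  ∑-const zero    c = refl
  ∑-const (suc k) c rewrite ∑-const k c = +-comm (k * c) c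

  term≤∑ : ∀ k (f : ℕ → ℕ) {j} → j < k → f j ≤ ∑< k f
  term≤∑ (suc k) f j<1+k with m<1+n⇒m<n∨m≡n j<1+k
  ... | inj₁ j<k  = ≤-trans (term≤∑ k f j<k) (m≤m+n _ _)
  ... | inj₂ refl = m≤n+m _ _

  ∑-pos⇒term-pos : ∀ k (f : ℕ → ℕ) → 0 < ∑< k f → ∃ λ j → j < k × 0 < f j
  ∑-pos⇒term-pos (suc k) f 0<∑ with f k in eq
  ... | suc _ = k , ≤-refl , subst (0 <_) (sym eq) z<s
  ... | zero  with j , j<k , 0<fj ← ∑-pos⇒term-pos k f (subst (0 <_) (+-identityʳ _) 0<∑)
    = j , m<n⇒m<1+n j<k , 0<fj

  ∑-suc : ∀ k (f : ℕ → ℕ) → ∑< (suc k) f ≡ f 0 + ∑[ i < k ] f (suc i)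
  ∑-suc zero    f = +-comm 0 (f 0)
  ∑-suc (suc k) f rewrite ∑-suc k f = +-assoc (f 0) _ (f (suc k))

  ∑-periodic-shift : ∀ k (f : ℕ → ℕ) → f k ≡ f 0 → ∑[ i < k ] f (suc i) ≡ ∑< k f
  ∑-periodic-shift k f fk≡f0 = +-cancelˡ-≡ (f 0) _ _ (begin
    f 0 + ∑[ i < k ] f (suc i) ≡⟨ ∑-suc k f ⟨
    ∑< k f + f k               ≡⟨ cong (∑< k f +_) fk≡f0 ⟩
    ∑< k f + f 0               ≡⟨ +-comm (∑< k f) (f 0) ⟩
    f 0 + ∑< k f               ∎)

  ∑-rotate : ∀ M .{{_ : NonZero M}} (f : ℕ → ℕ) z → ∑[ x < M ] f ((x + z) % M) ≡ ∑< M f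
  ∑-rotate M f zero = ∑-cong M (λ {x} x<M → cong f (trans (cong (_% M) (+-identityʳ x)) (m<n⇒m%n≡m x<M)))
  ∑-rotate M f (suc z) = begin
    ∑[ x < M ] f ((x + suc z) % M)   ≡⟨ ∑-cong M (λ {x} _ → cong (λ y → f (y % M)) (+-suc x z)) ⟩
    ∑[ x < M ] f ((suc x + z) % M)   ≡⟨ ∑-periodic-shift M (λ x → f ((x + z) % M)) (cong f M+z≡z) ⟩
    ∑[ x < M ] f ((x + z) % M)       ≡⟨ ∑-rotate M f z ⟩
    ∑< M f                           ∎
    where M+z≡z : (M + z) % M ≡ z % M
          M+z≡z = trans (cong (_% M) (+-comm M z)) ([m+n]%n≡m%n z M)

module BoundedSearch where

  open import Data.Bool using (Bool; T; true; _∧_)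
  open import Data.Bool.Properties using (T-≡; T-∧)
  open import Data.Bool.ListAction using (any; all)
  open import Data.List using (upTo)
  open import Data.List.Relation.Unary.All as All using ()
  open import Data.List.Relation.Unary.All.Properties using (all⁺; all⁻)
  open import Data.List.Relation.Unary.Any.Properties using (any⁺; any⁻)
  open import Data.List.Membership.Propositional using (lose; find)
  open import Data.List.Membership.Propositional.Properties using (∈-upTo⁺; ∈-upTo⁻)
  open import Data.Nat using (ℕ; _<_)
  open import Data.Product using (∃; _×_; _,_)
  open import Function using (_∘_; Equivalence)
  open import Relation.Binary.PropositionalEquality using (_≡_)

  T⇒≡ : ∀ {b} → T b → b ≡ true
  T⇒≡ = Equivalence.to T-≡

  ≡⇒T : ∀ {b} → b ≡ true → T b
  ≡⇒T = Equivalence.from T-≡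

  T-∧⁺ : ∀ {a b} → T a → T b → T (a ∧ b)
  T-∧⁺ ta tb = Equivalence.from T-∧ (ta , tb)

  T-∧⁻ : ∀ {a b} → T (a ∧ b) → T a × T b
  T-∧⁻ = Equivalence.to T-∧

  ∃<⇒any : ∀ {k} (f : ℕ → Bool) {i} → i < k → T (f i) → T (any f (upTo k))
  ∃<⇒any f i<k fi = any⁺ f (lose (∈-upTo⁺ i<k) fi)

  any⇒∃< : ∀ {k} (f : ℕ → Bool) → T (any f (upTo k)) → ∃ λ i → i < k × T (f i)
  any⇒∃< f any-f with i , i∈ , fi ← find (any⁻ f _ any-f) = i , ∈-upTo⁻ i∈ , fi

  ∀<⇒all : ∀ {k} (f : ℕ → Bool) → (∀ {i} → i < k → T (f i)) → T (all f (upTo k))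
  ∀<⇒all f ∀f = all⁻ f (All.tabulate (∀f ∘ ∈-upTo⁻))

  all⇒∀< : ∀ {k} (f : ℕ → Bool) → T (all f (upTo k)) → ∀ {i} → i < k → T (f i)
  all⇒∀< f all-f i<k = All.lookup (all⁺ f _ all-f) (∈-upTo⁺ i<k)

module DoubleNegation where

  open import Data.Nat
  open import Data.Nat.Properties using (m<1+n⇒m<n∨m≡n)
  open import Data.Sum using (inj₁; inj₂)
  open import Function using (case_of_)
  open import Relation.Binary.PropositionalEquality using (refl)
  open import Relation.Nullary using (¬_; Dec)
  open import Relation.Nullary.Decidable using (¬¬-excluded-middle)

  ¬¬-decidable-below : ∀ {P : ℕ → Set} k → ¬ ¬ (∀ r → r < k → Dec (P r))
  ¬¬-decidable-below zero    ¬dec = ¬dec λ _ ()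
  ¬¬-decidable-below (suc k) ¬dec = ¬¬-decidable-below k λ dec<k → ¬¬-excluded-middle λ dec-k →
    ¬dec λ r r<1+k → case m<1+n⇒m<n∨m≡n r<1+k of λ where
      (inj₁ r<k)  → dec<k r r<k
      (inj₂ refl) → dec-k

-- A subset of ℤ/Mℤ is a Subset read on the representatives 0, …, M - 1.
module Residues (M : ℕ) .{{_ : NonZero M}} where

  open import Data.Bool using (true; false; T; _∧_; _∨_; not)
  open import Data.Bool.Properties using (∨-zeroʳ)
  open import Data.Bool.ListAction using (any; all)
  open import Data.List using (upTo)
  open import Data.Nat
  open import Data.Nat.Properties
  open import Data.Nat.DivMod
  open import Data.Product using (∃; ∃₂; _×_; _,_)
  open import Data.Sum using (_⊎_; inj₁; inj₂)
  open import Function using (_∘_)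
  open import Relation.Binary.PropositionalEquality
  open import Relation.Nullary using (¬_; Dec; contradiction)
  open import Relation.Nullary.Decidable using (map′)
  open import Relation.Nullary.Negation using (¬¬-map)
  open import Defs using (Subset; _∈_)
  open FiniteSums
  open BoundedSearch
  open DoubleNegation

  infix 4 _≡ᴹ_
  _≡ᴹ_ : ℕ → ℕ → Set
  x ≡ᴹ y = x % M ≡ y % M

  %-≡ᴹ : ∀ x → x % M ≡ᴹ x
  %-≡ᴹ x = m%n%n≡m%n x M

  +-congᴹ : ∀ {a b c d} → a ≡ᴹ b → c ≡ᴹ d → a + c ≡ᴹ b + d
  +-congᴹ {a} {b} {c} {d} a≡b c≡d = begin
    (a + c) % M             ≡⟨ %-distribˡ-+ a c M ⟩
    (a % M + c % M) % M     ≡⟨ cong₂ (λ x y → (x + y) % M) a≡b c≡d ⟩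
    (b % M + d % M) % M     ≡⟨ %-distribˡ-+ b d M ⟨
    (b + d) % M             ∎
    where open ≡-Reasoning

  infix 4 _∈ᴹ_ _⊆ᴹ_
  infixr 5 _∪_ _∩_

  _∈ᴹ_ : ℕ → Subset → Set
  x ∈ᴹ P = (x % M) ∈ P

  ∈ᴹ-resp : ∀ {x y} P → x ≡ᴹ y → x ∈ᴹ P → y ∈ᴹ P
  ∈ᴹ-resp P x≡y = subst (_∈ P) x≡y

  ∈⇒∈ᴹ : ∀ {r} P → r < M → r ∈ P → r ∈ᴹ P
  ∈⇒∈ᴹ P r<M = subst (_∈ P) (sym (m<n⇒m%n≡m r<M))

  ∈ᴹ⇒∈ : ∀ {r} P → r < M → r ∈ᴹ P → r ∈ P
  ∈ᴹ⇒∈ P r<M = subst (_∈ P) (m<n⇒m%n≡m r<M)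

  _⊆ᴹ_ : Subset → Subset → Set
  P ⊆ᴹ Q = ∀ {x} → x ∈ᴹ P → x ∈ᴹ Q

  ∣_∣ : Subset → ℕ
  ∣ P ∣ = ∑[ r < M ] 𝟙 (P r)

  ∣∣-mono : ∀ {P Q} → P ⊆ᴹ Q → ∣ P ∣ ≤ ∣ Q ∣
  ∣∣-mono {P} {Q} P⊆Q = ∑-mono-≤ M (λ r<M → 𝟙-mono (∈ᴹ⇒∈ Q r<M ∘ P⊆Q ∘ ∈⇒∈ᴹ P r<M))

  ∣∣-cong : ∀ {P Q} → P ⊆ᴹ Q → Q ⊆ᴹ P → ∣ P ∣ ≡ ∣ Q ∣
  ∣∣-cong P⊆Q Q⊆P = ≤-antisym (∣∣-mono P⊆Q) (∣∣-mono Q⊆P)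

  ∣P∣≤M : ∀ P → ∣ P ∣ ≤ M
  ∣P∣≤M P = ≤-trans (∑-mono-≤ M (λ {r} _ → 𝟙≤1 (P r))) (≤-reflexive (trans (∑-const M 1) (*-identityʳ M)))

  W⊆X∧∣X∣≤∣W∣⇒X⊆W : ∀ {W X} → W ⊆ᴹ X → ∣ X ∣ ≤ ∣ W ∣ → X ⊆ᴹ W
  W⊆X∧∣X∣≤∣W∣⇒X⊆W {W} {X} W⊆X ∣X∣≤∣W∣ {x} x∈X with W (x % M) in x∈W
  ... | true  = refl
  ... | false = contradiction ∣W∣<∣X∣ (≤⇒≯ ∣X∣≤∣W∣)
    where
    ∣W∣<∣X∣ : ∣ W ∣ < ∣ X ∣
    ∣W∣<∣X∣ = ∑-mono-< M (λ r<M → 𝟙-mono (∈ᴹ⇒∈ X r<M ∘ W⊆X ∘ ∈⇒∈ᴹ W r<M)) (m%n<n x M)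
                (subst₂ (λ w v → 𝟙 w < 𝟙 v) (sym x∈W) (sym x∈X) ≤-refl)

  ∣P∣>0⇒∃∈ : ∀ P → 0 < ∣ P ∣ → ∃ λ x → x ∈ᴹ P
  ∣P∣>0⇒∃∈ P 0<∣P∣ with r , r<M , 0<𝟙 ← ∑-pos⇒term-pos M (𝟙 ∘ P) 0<∣P∣ = r , ∈⇒∈ᴹ P r<M (𝟙-pos 0<𝟙)
    where
    𝟙-pos : ∀ {b} → 0 < 𝟙 b → b ≡ true
    𝟙-pos {true} _ = refl

  _∪_ _∩_ : Subset → Subset → Subset
  (P ∪ Q) r = P r ∨ Q r
  (P ∩ Q) r = P r ∧ Q r

  ∣P∪Q∣+∣P∩Q∣≡∣P∣+∣Q∣ : ∀ P Q → ∣ P ∪ Q ∣ + ∣ P ∩ Q ∣ ≡ ∣ P ∣ + ∣ Q ∣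
  ∣P∪Q∣+∣P∩Q∣≡∣P∣+∣Q∣ P Q = begin
    ∣ P ∪ Q ∣ + ∣ P ∩ Q ∣                      ≡⟨ ∑-distrib-+ M _ _ ⟨
    ∑[ r < M ] (𝟙 (P r ∨ Q r) + 𝟙 (P r ∧ Q r)) ≡⟨ ∑-cong M (λ {r} _ → 𝟙-∨-∧ (P r) (Q r)) ⟩
    ∑[ r < M ] (𝟙 (P r) + 𝟙 (Q r))             ≡⟨ ∑-distrib-+ M _ _ ⟩
    ∣ P ∣ + ∣ Q ∣                              ∎
    where
    open ≡-Reasoning
    𝟙-∨-∧ : ∀ a b → 𝟙 (a ∨ b) + 𝟙 (a ∧ b) ≡ 𝟙 a + 𝟙 b
    𝟙-∨-∧ true  true  = refl
    𝟙-∨-∧ true  false = refl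
    𝟙-∨-∧ false b     = +-identityʳ (𝟙 b)

  ∈-∩⁺ : ∀ {x} P Q → x ∈ᴹ P → x ∈ᴹ Q → x ∈ᴹ P ∩ Q
  ∈-∩⁺ P Q x∈P x∈Q rewrite x∈P = x∈Q

  ∈-∩⁻ : ∀ {x} P Q → x ∈ᴹ P ∩ Q → x ∈ᴹ P × x ∈ᴹ Q
  ∈-∩⁻ {x} P Q x∈P∩Q with P (x % M) | Q (x % M)
  ∈-∩⁻ P Q refl | true | true = refl , refl

  ∈-∪⁺ˡ : ∀ {x} P Q → x ∈ᴹ P → x ∈ᴹ P ∪ Q
  ∈-∪⁺ˡ P Q x∈P rewrite x∈P = refl

  ∈-∪⁺ʳ : ∀ {x} P Q → x ∈ᴹ Q → x ∈ᴹ P ∪ Q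
  ∈-∪⁺ʳ {x} P Q x∈Q rewrite x∈Q = ∨-zeroʳ (P (x % M))

  ∈-∪⁻ : ∀ {x} P Q → x ∈ᴹ P ∪ Q → x ∈ᴹ P ⊎ x ∈ᴹ Q
  ∈-∪⁻ {x} P Q x∈P∪Q with P (x % M)
  ... | true  = inj₁ refl
  ... | false = inj₂ x∈P∪Q

  infixl 6 _⊖_
  _⊖_ : ℕ → ℕ → ℕ
  x ⊖ z = x + (M ∸ z % M)

  ⊖-+ : ∀ x z → x ⊖ z + z ≡ᴹ x
  ⊖-+ x z = begin
    (x + (M ∸ z % M) + z) % M       ≡⟨ +-congᴹ {x + (M ∸ z % M)} refl (sym (%-≡ᴹ z)) ⟩
    (x + (M ∸ z % M) + z % M) % M   ≡⟨ cong (_% M) (+-assoc x _ (z % M)) ⟩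
    (x + ((M ∸ z % M) + z % M)) % M ≡⟨ cong (λ y → (x + y) % M) (m∸n+n≡m (m%n≤n z M)) ⟩
    (x + M) % M                     ≡⟨ [m+n]%n≡m%n x M ⟩
    x % M                           ∎
    where open ≡-Reasoning

  +-⊖ : ∀ x z → x + z ⊖ z ≡ᴹ x
  +-⊖ x z = begin
    (x + z + (M ∸ z % M)) % M       ≡⟨ cong (_% M) (+-assoc x z _) ⟩
    (x + (z + (M ∸ z % M))) % M     ≡⟨ +-congᴹ {x} refl (+-congᴹ {z} (sym (%-≡ᴹ z)) refl) ⟩
    (x + (z % M + (M ∸ z % M))) % M ≡⟨ cong (λ y → (x + y) % M) (m+[n∸m]≡n (m%n≤n z M)) ⟩
    (x + M) % M                     ≡⟨ [m+n]%n≡m%n x M ⟩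
    x % M                           ∎
    where open ≡-Reasoning

  +-cancelʳ-≡ᴹ : ∀ {a b} c → a + c ≡ᴹ b + c → a ≡ᴹ b
  +-cancelʳ-≡ᴹ {a} {b} c a+c≡b+c = begin
    a % M               ≡⟨ +-⊖ a c ⟨
    (a + c ⊖ c) % M     ≡⟨ +-congᴹ {a + c} a+c≡b+c refl ⟩
    (b + c ⊖ c) % M     ≡⟨ +-⊖ b c ⟩
    b % M               ∎
    where open ≡-Reasoning

  shift : ℕ → Subset → Subset
  shift z P r = P ((r ⊖ z) % M)

  ∈-shift⁺ : ∀ {x} z P → x ∈ᴹ P → x + z ∈ᴹ shift z P
  ∈-shift⁺ {x} z P = ∈ᴹ-resp P (sym (trans (+-congᴹ {(x + z) % M} (%-≡ᴹ (x + z)) refl) (+-⊖ x z)))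

  ∈-shift⁻ : ∀ {x} z P → x ∈ᴹ shift z P → ∃ λ p → p ∈ᴹ P × p + z ≡ᴹ x
  ∈-shift⁻ {x} z P x∈ = x % M ⊖ z , x∈ , trans (⊖-+ (x % M) z) (%-≡ᴹ x)

  ∣shift∣ : ∀ z P → ∣ shift z P ∣ ≡ ∣ P ∣
  ∣shift∣ z P = ∑-rotate M (𝟙 ∘ P) (M ∸ z % M)

  infixl 6 _⊕_
  _⊕_ : Subset → Subset → Subset
  (P ⊕ Q) r = any (λ p → P p ∧ any (λ q → Q q ∧ ((p + q) % M ≡ᵇ r)) (upTo M)) (upTo M)

  ∈-⊕⁺ : ∀ {p q} P Q → p ∈ᴹ P → q ∈ᴹ Q → p + q ∈ᴹ P ⊕ Q
  ∈-⊕⁺ {p} {q} P Q p∈P q∈Q = T⇒≡ (∃<⇒any _ (m%n<n p M) (T-∧⁺ (≡⇒T p∈P)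
                               (∃<⇒any _ (m%n<n q M) (T-∧⁺ (≡⇒T q∈Q)
                                 (≡⇒≡ᵇ _ _ (sym (%-distribˡ-+ p q M)))))))

  ∈-⊕⁻ : ∀ {x} P Q → x ∈ᴹ P ⊕ Q → ∃₂ λ p q → p ∈ᴹ P × q ∈ᴹ Q × p + q ≡ᴹ x
  ∈-⊕⁻ {x} P Q x∈P⊕Q
    with p , p<M , P∧ ← any⇒∃< _ (≡⇒T x∈P⊕Q)
    with p∈P , any-q ← T-∧⁻ P∧
    with q , q<M , Q∧ ← any⇒∃< _ any-q
    with q∈Q , p+q≡x ← T-∧⁻ Q∧
    = p , q , ∈⇒∈ᴹ P p<M (T⇒≡ p∈P) , ∈⇒∈ᴹ Q q<M (T⇒≡ q∈Q) , ≡ᵇ⇒≡ _ _ p+q≡x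

  ⊕-mono : ∀ {P P′ Q Q′} → P ⊆ᴹ P′ → Q ⊆ᴹ Q′ → P ⊕ Q ⊆ᴹ P′ ⊕ Q′
  ⊕-mono {P} {P′} {Q} {Q′} P⊆P′ Q⊆Q′ x∈P⊕Q with p , q , p∈P , q∈Q , p+q≡x ← ∈-⊕⁻ P Q x∈P⊕Q =
    ∈ᴹ-resp (P′ ⊕ Q′) p+q≡x (∈-⊕⁺ P′ Q′ (P⊆P′ p∈P) (Q⊆Q′ q∈Q))

  ⊕-assoc : ∀ P Q R → P ⊕ (Q ⊕ R) ⊆ᴹ P ⊕ Q ⊕ R
  ⊕-assoc P Q R x∈
    with p , v , p∈P , v∈Q⊕R , p+v≡x ← ∈-⊕⁻ P (Q ⊕ R) x∈
    with q , r , q∈Q , r∈R , q+r≡v ← ∈-⊕⁻ Q R v∈Q⊕R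
    = ∈ᴹ-resp (P ⊕ Q ⊕ R) (trans (cong (_% M) (+-assoc p q r)) (trans (+-congᴹ {p} refl q+r≡v) p+v≡x))
        (∈-⊕⁺ (P ⊕ Q) R (∈-⊕⁺ P Q p∈P q∈Q) r∈R)

  shift-mono : ∀ {P Q} z → P ⊆ᴹ Q → shift z P ⊆ᴹ shift z Q
  shift-mono z P⊆Q = P⊆Q

  shift⊆⊕ : ∀ {x} X Y → x ∈ᴹ X → shift x Y ⊆ᴹ X ⊕ Y
  shift⊆⊕ {x} X Y x∈X r∈ with y , y∈Y , y+x≡r ← ∈-shift⁻ x Y r∈ =
    ∈ᴹ-resp (X ⊕ Y) (trans (cong (_% M) (+-comm x y)) y+x≡r) (∈-⊕⁺ X Y x∈X y∈Y)

  ∣Y∣≤∣X⊕Y∣ : ∀ {x} X Y → x ∈ᴹ X → ∣ Y ∣ ≤ ∣ X ⊕ Y ∣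
  ∣Y∣≤∣X⊕Y∣ {x} X Y x∈X = ≤-trans (≤-reflexive (sym (∣shift∣ x Y))) (∣∣-mono (shift⊆⊕ X Y x∈X))

  A⊆C∪D∧B⊆C∩D⇒∣A∣+∣B∣≤∣C∣+∣D∣ : ∀ {A B C D} → A ⊆ᴹ C ∪ D → B ⊆ᴹ C ∩ D → ∣ A ∣ + ∣ B ∣ ≤ ∣ C ∣ + ∣ D ∣
  A⊆C∪D∧B⊆C∩D⇒∣A∣+∣B∣≤∣C∣+∣D∣ {C = C} {D} A⊆ B⊆ =
    ≤-trans (+-mono-≤ (∣∣-mono A⊆) (∣∣-mono B⊆)) (≤-reflexive (∣P∪Q∣+∣P∩Q∣≡∣P∣+∣Q∣ C D))

  C∪D⊆A∧C∩D⊆B⇒∣C∣+∣D∣≤∣A∣+∣B∣ : ∀ {A B C D} → C ∪ D ⊆ᴹ A → C ∩ D ⊆ᴹ B → ∣ C ∣ + ∣ D ∣ ≤ ∣ A ∣ + ∣ B ∣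
  C∪D⊆A∧C∩D⊆B⇒∣C∣+∣D∣≤∣A∣+∣B∣ {C = C} {D} ⊆A ⊆B =
    ≤-trans (≤-reflexive (sym (∣P∪Q∣+∣P∩Q∣≡∣P∣+∣Q∣ C D))) (+-mono-≤ (∣∣-mono ⊆A) (∣∣-mono ⊆B))

  ∣∣≡0 : ∀ P → (∀ {x} → ¬ x ∈ᴹ P) → ∣ P ∣ ≡ 0
  ∣∣≡0 P ∉P = trans (∑-cong M (λ {r} r<M → 𝟙-false (λ r∈P → ∉P (∈⇒∈ᴹ P r<M r∈P)))) (trans (∑-const M 0) (*-zeroʳ M))
    where
    𝟙-false : ∀ {b} → ¬ b ≡ true → 𝟙 b ≡ 0
    𝟙-false {true}  b≢true = contradiction refl b≢true
    𝟙-false {false} _      = refl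

  infixl 6 _⊘_
  _⊘_ : Subset → Subset → Subset
  (Q ⊘ S) r = all (λ s → not (S s) ∨ Q ((r + s) % M)) (upTo M)

  ∈-⊘⁺ : ∀ {x} Q S → (∀ {s} → s ∈ᴹ S → x + s ∈ᴹ Q) → x ∈ᴹ Q ⊘ S
  ∈-⊘⁺ {x} Q S x+S⊆Q = T⇒≡ (∀<⇒all _ x+s∈Q)
    where
    x+s∈Q : ∀ {s} → s < M → T (not (S s) ∨ Q ((x % M + s) % M))
    x+s∈Q {s} s<M with S s in s∈S
    ... | false = _
    ... | true  = ≡⇒T (∈ᴹ-resp Q (+-congᴹ {x} (sym (%-≡ᴹ x)) refl) (x+S⊆Q (∈⇒∈ᴹ S s<M s∈S)))

  ∈-⊘⁻ : ∀ {x s} Q S → x ∈ᴹ Q ⊘ S → s ∈ᴹ S → x + s ∈ᴹ Q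
  ∈-⊘⁻ {x} {s} Q S x∈Q⊘S s∈S with S (s % M) | all⇒∀< _ (≡⇒T x∈Q⊘S) (m%n<n s M)
  ... | true | x+s∈Q = ∈ᴹ-resp Q (sym (%-distribˡ-+ x s M)) (T⇒≡ x+s∈Q)

  _⊆ᴹ_beyond_ : Subset → Subset → ℕ → Set
  R ⊆ᴹ A beyond T = ∀ {x} → T ≤ x → x ∈ᴹ R → x ∈ A

  OccursIn : Subset → ℕ → Set
  OccursIn A r = ∃ λ x → x ∈ A × x ≡ᴹ r

  ¬¬-occurs? : ∀ A → ¬ ¬ (∀ r → Dec (OccursIn A r))
  ¬¬-occurs? A = ¬¬-map (λ occurs<M? r → map′ (λ (x , x∈A , x≡r%M) → x , x∈A , trans x≡r%M (%-≡ᴹ r))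
                                                (λ (x , x∈A , x≡r) → x , x∈A , trans x≡r (sym (%-≡ᴹ r)))
                                                (occurs<M? (r % M) (m%n<n r M)))
                        (¬¬-decidable-below {OccursIn A} M)

module Petridis (M : ℕ) .{{_ : NonZero M}} where

  open import Data.Bool using (true; _∧_)
  open import Data.Bool.Properties using () renaming (_≟_ to _≟ᵇ_)
  open import Data.Nat
  open import Data.Nat.Properties
  open import Data.Nat.DivMod
  open import Data.Nat.Induction using (<-wellFounded)
  open import Data.Nat.Tactic.RingSolver using (solve)
  open import Algebra.Properties.CommutativeSemigroup +-commutativeSemigroup using (x∙yz≈xz∙y; xy∙z≈xz∙y)
  open import Data.List using (_∷_; [])
  open import Data.Product using (∃; _×_; _,_; proj₁; proj₂)
  open import Data.Sum using (_⊎_; inj₁; inj₂)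
  open import Function using (_∘_; _on_; id)
  open import Induction.WellFounded using (Acc; acc)
  open import Relation.Binary.PropositionalEquality
  open import Relation.Binary.Construct.On using (wellFounded)
  open import Relation.Nullary using (¬_; yes; no; contradiction)
  open import Relation.Nullary.Decidable using (_×-dec_; decidable-stable; ¬¬-excluded-middle)
  open import Defs using (Subset)
  open BoundedSearch using (T⇒≡; ≡⇒T; T-∧⁻)
  open Residues M

  infixl 7 _↾_
  _↾_ : Subset → ℕ → Subset
  (Z ↾ k) r = Z r ∧ (r <ᵇ k)

  ∈-↾⁺ : ∀ {x} Z k → x ∈ᴹ Z → x % M < k → x ∈ᴹ Z ↾ k
  ∈-↾⁺ Z k x∈Z x%M<k rewrite x∈Z = T⇒≡ (<⇒<ᵇ x%M<k)

  ∈-↾⁻ : ∀ {x} Z k → x ∈ᴹ Z ↾ k → x ∈ᴹ Z × x % M < k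
  ∈-↾⁻ Z k x∈Z↾k with x∈Z , x%M<k ← T-∧⁻ (≡⇒T x∈Z↾k) = T⇒≡ x∈Z , <ᵇ⇒< _ _ x%M<k

  ↾-⊆ : ∀ Z k → Z ↾ k ⊆ᴹ Z
  ↾-⊆ Z k = proj₁ ∘ ∈-↾⁻ Z k

  ⊆-↾M : ∀ Z → Z ⊆ᴹ Z ↾ M
  ⊆-↾M Z {x} x∈Z = ∈-↾⁺ Z M x∈Z (m%n<n x M)

  ↾-⊆-↾suc : ∀ Z k → Z ↾ k ⊆ᴹ Z ↾ suc k
  ↾-⊆-↾suc Z k x∈ with x∈Z , x%M<k ← ∈-↾⁻ Z k x∈ = ∈-↾⁺ Z (suc k) x∈Z (m<n⇒m<1+n x%M<k)

  ↾suc-⊆ : ∀ Z k {x} → x ∈ᴹ Z ↾ suc k → x ∈ᴹ Z ↾ k ⊎ x % M ≡ k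
  ↾suc-⊆ Z k x∈ with ∈-↾⁻ Z (suc k) x∈
  ... | x∈Z , x%M<1+k with m<1+n⇒m<n∨m≡n x%M<1+k
  ...   | inj₁ x%M<k = inj₁ (∈-↾⁺ Z k x∈Z x%M<k)
  ...   | inj₂ x%M≡k = inj₂ x%M≡k

  -- One step of Petridis' induction, adding the translate k to Z:
  -- W is the set of x ∈ X with x + Y + k ⊆ X + Y + Z.
  module PetridisStep (X Y Z Z′ : Subset) (k : ℕ) (Z⊆Z′ : Z ⊆ᴹ Z′) (k∈Z′ : k ∈ᴹ Z′)
                      (Z′⊆Z∪k : ∀ {z} → z ∈ᴹ Z′ → z ∈ᴹ Z ⊎ z ≡ᴹ k) where

    Q W : Subset
    Q = X ⊕ Y ⊕ Z
    W = X ∩ (Q ⊘ shift k Y)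

    W⊆X : W ⊆ᴹ X
    W⊆X = proj₁ ∘ ∈-∩⁻ X (Q ⊘ shift k Y)

    XYZ′⊆Q∪XY+k : X ⊕ Y ⊕ Z′ ⊆ᴹ Q ∪ shift k (X ⊕ Y)
    XYZ′⊆Q∪XY+k x∈ with ∈-⊕⁻ (X ⊕ Y) Z′ x∈
    ... | v , z , v∈X⊕Y , z∈Z′ , v+z≡x with Z′⊆Z∪k z∈Z′
    ...   | inj₁ z∈Z = ∈-∪⁺ˡ Q (shift k (X ⊕ Y)) (∈ᴹ-resp Q v+z≡x (∈-⊕⁺ (X ⊕ Y) Z v∈X⊕Y z∈Z))
    ...   | inj₂ z≡k = ∈-∪⁺ʳ Q (shift k (X ⊕ Y)) (∈ᴹ-resp (shift k (X ⊕ Y)) (trans (+-congᴹ {v} refl (sym z≡k)) v+z≡x)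
                                                     (∈-shift⁺ k (X ⊕ Y) v∈X⊕Y))

    WY+k⊆Q∩XY+k : shift k (W ⊕ Y) ⊆ᴹ Q ∩ shift k (X ⊕ Y)
    WY+k⊆Q∩XY+k x∈
      with v , v∈W⊕Y , v+k≡x ← ∈-shift⁻ k (W ⊕ Y) x∈
      with w , y , w∈W , y∈Y , w+y≡v ← ∈-⊕⁻ W Y v∈W⊕Y
      = ∈-∩⁺ Q (shift k (X ⊕ Y))
          (∈ᴹ-resp Q (trans (cong (_% M) (sym (+-assoc w y k))) (trans (+-congᴹ w+y≡v refl) v+k≡x))
            (∈-⊘⁻ Q (shift k Y) (proj₂ (∈-∩⁻ X (Q ⊘ shift k Y) w∈W)) (∈-shift⁺ k Y y∈Y)))
          (shift-mono {W ⊕ Y} {X ⊕ Y} k (⊕-mono {W} {X} {Y} {Y} W⊆X id) x∈)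

    XZ∪X+k⊆XZ′ : X ⊕ Z ∪ shift k X ⊆ᴹ X ⊕ Z′
    XZ∪X+k⊆XZ′ {x} x∈ with ∈-∪⁻ {x} (X ⊕ Z) (shift k X) x∈
    ... | inj₁ x∈X⊕Z  = ⊕-mono id Z⊆Z′ x∈X⊕Z
    ... | inj₂ x∈X+k with p , p∈X , p+k≡x ← ∈-shift⁻ k X x∈X+k = ∈ᴹ-resp (X ⊕ Z′) p+k≡x (∈-⊕⁺ X Z′ p∈X k∈Z′)

    XZ∩X+k⊆W+k : X ⊕ Z ∩ shift k X ⊆ᴹ shift k W
    XZ∩X+k⊆W+k x∈
      with x∈X⊕Z , x∈X+k ← ∈-∩⁻ (X ⊕ Z) (shift k X) x∈
      with p , p∈X , p+k≡x ← ∈-shift⁻ k X x∈X+k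
      with x′ , z , x′∈X , z∈Z , x′+z≡x ← ∈-⊕⁻ X Z x∈X⊕Z
      = ∈ᴹ-resp (shift k W) p+k≡x (∈-shift⁺ k W (∈-∩⁺ X (Q ⊘ shift k Y) p∈X (∈-⊘⁺ Q (shift k Y) p+Y+k⊆Q)))
      where
      p+Y+k⊆Q : ∀ {s} → s ∈ᴹ shift k Y → p + s ∈ᴹ Q
      p+Y+k⊆Q {s} s∈ with y , y∈Y , y+k≡s ← ∈-shift⁻ k Y s∈ =
        ∈ᴹ-resp Q (sym (begin
          (p + s) % M       ≡⟨ +-congᴹ {p} refl (sym y+k≡s) ⟩
          (p + (y + k)) % M ≡⟨ cong (_% M) (x∙yz≈xz∙y p y k) ⟩
          (p + k + y) % M   ≡⟨ +-congᴹ p+k≡x refl ⟩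
          (_ + y) % M       ≡⟨ +-congᴹ (sym x′+z≡x) refl ⟩
          (x′ + z + y) % M  ≡⟨ cong (_% M) (xy∙z≈xz∙y x′ z y) ⟩
          (x′ + y + z) % M  ∎))
          (∈-⊕⁺ (X ⊕ Y) Z (∈-⊕⁺ X Y x′∈X y∈Y) z∈Z)
        where open ≡-Reasoning

    ∣XYZ′∣+∣WY∣≤∣Q∣+∣XY∣ : ∣ X ⊕ Y ⊕ Z′ ∣ + ∣ W ⊕ Y ∣ ≤ ∣ Q ∣ + ∣ X ⊕ Y ∣
    ∣XYZ′∣+∣WY∣≤∣Q∣+∣XY∣ = subst₂ (λ a b → ∣ X ⊕ Y ⊕ Z′ ∣ + a ≤ ∣ Q ∣ + b) (∣shift∣ k (W ⊕ Y)) (∣shift∣ k (X ⊕ Y))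
                              (A⊆C∪D∧B⊆C∩D⇒∣A∣+∣B∣≤∣C∣+∣D∣ XYZ′⊆Q∪XY+k WY+k⊆Q∩XY+k)

    ∣XZ∣+∣X∣≤∣XZ′∣+∣W∣ : ∣ X ⊕ Z ∣ + ∣ X ∣ ≤ ∣ X ⊕ Z′ ∣ + ∣ W ∣
    ∣XZ∣+∣X∣≤∣XZ′∣+∣W∣ = subst₂ (λ a b → ∣ X ⊕ Z ∣ + a ≤ ∣ X ⊕ Z′ ∣ + b) (∣shift∣ k X) (∣shift∣ k W)
                            (C∪D⊆A∧C∩D⊆B⇒∣C∣+∣D∣≤∣A∣+∣B∣ XZ∪X+k⊆XZ′ XZ∩X+k⊆W+k)

  petridis-arithmetic : ∀ a b q s x n x′ w → a + b ≤ q + s → q * n ≤ s * x → x + n ≤ x′ + w → s * w ≤ b * n →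
                        a * n ≤ s * x′
  petridis-arithmetic a b q s x n x′ w a+b≤q+s qn≤sx x+n≤x′+w sw≤bn = +-cancelʳ-≤ (b * n) (a * n) (s * x′) (begin
    a * n + b * n   ≡⟨ *-distribʳ-+ n a b ⟨
    (a + b) * n     ≤⟨ *-monoˡ-≤ n a+b≤q+s ⟩
    (q + s) * n     ≡⟨ *-distribʳ-+ n q s ⟩
    q * n + s * n   ≤⟨ +-monoˡ-≤ (s * n) qn≤sx ⟩
    s * x + s * n   ≡⟨ *-distribˡ-+ s x n ⟨
    s * (x + n)     ≤⟨ *-monoʳ-≤ s x+n≤x′+w ⟩
    s * (x′ + w)    ≡⟨ *-distribˡ-+ s x′ w ⟩
    s * x′ + s * w  ≤⟨ +-monoʳ-≤ (s * x′) sw≤bn ⟩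
    s * x′ + b * n  ∎)
    where open ≤-Reasoning

  RatioMinimal : Subset → Subset → Set
  RatioMinimal Y X = ∀ {W} → W ⊆ᴹ X → ∣ X ⊕ Y ∣ * ∣ W ∣ ≤ ∣ W ⊕ Y ∣ * ∣ X ∣

  module _ {X Y : Subset} (minimal : RatioMinimal Y X) where

    petridis-↾ : ∀ Z k → ∣ X ⊕ Y ⊕ Z ↾ k ∣ * ∣ X ∣ ≤ ∣ X ⊕ Y ∣ * ∣ X ⊕ Z ↾ k ∣
    petridis-↾ Z zero = ≤-trans (≤-reflexive (cong (_* ∣ X ∣) (∣∣≡0 (X ⊕ Y ⊕ Z ↾ 0) ∉XYZ↾0))) z≤n
      where
      ∉XYZ↾0 : ∀ {x} → ¬ x ∈ᴹ X ⊕ Y ⊕ Z ↾ 0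
      ∉XYZ↾0 x∈ with _ , _ , _ , z∈Z↾0 , _ ← ∈-⊕⁻ (X ⊕ Y) (Z ↾ 0) x∈ = n≮0 (proj₂ (∈-↾⁻ Z 0 z∈Z↾0))
    petridis-↾ Z (suc k) with Z k ≟ᵇ true ×-dec k <? M
    ... | yes (k∈Z , k<M) =
      petridis-arithmetic (∣ X ⊕ Y ⊕ Z ↾ suc k ∣) (∣ W ⊕ Y ∣) (∣ Q ∣) (∣ X ⊕ Y ∣) (∣ X ⊕ Z ↾ k ∣) (∣ X ∣)
                          (∣ X ⊕ Z ↾ suc k ∣) (∣ W ∣)
                          ∣XYZ′∣+∣WY∣≤∣Q∣+∣XY∣ (petridis-↾ Z k) ∣XZ∣+∣X∣≤∣XZ′∣+∣W∣ (minimal {W} W⊆X)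
      where
      Z↾1+k⊆Z↾k∪k : ∀ {z} → z ∈ᴹ Z ↾ suc k → z ∈ᴹ Z ↾ k ⊎ z ≡ᴹ k
      Z↾1+k⊆Z↾k∪k z∈ with ↾suc-⊆ Z k z∈
      ... | inj₁ z∈Z↾k = inj₁ z∈Z↾k
      ... | inj₂ z%M≡k = inj₂ (trans z%M≡k (sym (m<n⇒m%n≡m k<M)))
      open PetridisStep X Y (Z ↾ k) (Z ↾ suc k) k (↾-⊆-↾suc Z k) (∈-↾⁺ Z (suc k) (∈⇒∈ᴹ Z k<M k∈Z) (s≤s (m%n≤m k M)))
                        Z↾1+k⊆Z↾k∪k
    ... | no ¬[k∈Z×k<M] = subst₂ (λ a b → a * ∣ X ∣ ≤ ∣ X ⊕ Y ∣ * b)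
                            (∣∣-cong (⊕-mono id Z↾k⊆Z↾1+k) (⊕-mono id Z↾1+k⊆Z↾k))
                            (∣∣-cong (⊕-mono id Z↾k⊆Z↾1+k) (⊕-mono id Z↾1+k⊆Z↾k))
                            (petridis-↾ Z k)
      where
      Z↾k⊆Z↾1+k : Z ↾ k ⊆ᴹ Z ↾ suc k
      Z↾k⊆Z↾1+k = ↾-⊆-↾suc Z k
      Z↾1+k⊆Z↾k : Z ↾ suc k ⊆ᴹ Z ↾ k
      Z↾1+k⊆Z↾k {z} z∈ with ↾suc-⊆ Z k z∈
      ... | inj₁ z∈Z↾k = z∈Z↾k
      ... | inj₂ refl  = contradiction (↾-⊆ Z (suc k) z∈ , m%n<n z M) ¬[k∈Z×k<M]

  petridis : ∀ {X Y} → RatioMinimal Y X → ∀ Z → ∣ X ⊕ Y ⊕ Z ∣ * ∣ X ∣ ≤ ∣ X ⊕ Y ∣ * ∣ X ⊕ Z ∣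
  petridis {X} {Y} minimal Z = subst₂ (λ a b → a * ∣ X ∣ ≤ ∣ X ⊕ Y ∣ * b)
                                 (∣∣-cong (⊕-mono id (↾-⊆ Z M)) (⊕-mono id (⊆-↾M Z)))
                                 (∣∣-cong (⊕-mono id (↾-⊆ Z M)) (⊕-mono id (⊆-↾M Z)))
                                 (petridis-↾ minimal Z M)

  Improves : Subset → Subset → Subset → Set
  Improves Y X W = W ⊆ᴹ X × ∣ W ⊕ Y ∣ * ∣ X ∣ < ∣ X ⊕ Y ∣ * ∣ W ∣

  ¬improvable⇒minimal : ∀ {Y X} → ¬ ∃ (Improves Y X) → RatioMinimal Y X
  ¬improvable⇒minimal ¬improvable {W} W⊆X = decidable-stable (_ ≤? _) (λ ≰ → ¬improvable (W , W⊆X , ≰⇒> ≰))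

  improves⇒0<∣W∣ : ∀ {Y X W} → Improves Y X W → 0 < ∣ W ∣
  improves⇒0<∣W∣ {Y} {X} {W} (_ , better) with ∣ W ∣
  ... | zero  = contradiction (subst (∣ W ⊕ Y ∣ * ∣ X ∣ <_) (*-zeroʳ ∣ X ⊕ Y ∣) better) n≮0
  ... | suc _ = z<s

  improves⇒∣W∣<∣X∣ : ∀ {Y X W} → Improves Y X W → ∣ W ∣ < ∣ X ∣
  improves⇒∣W∣<∣X∣ {Y} {X} {W} (W⊆X , better) = ≰⇒> λ ∣X∣≤∣W∣ → <⇒≱ better
    (*-mono-≤ (∣∣-mono (⊕-mono {X} {W} {Y} {Y} (W⊆X∧∣X∣≤∣W∣⇒X⊆W W⊆X ∣X∣≤∣W∣) id)) (∣∣-mono W⊆X))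

  ratio-trans : ∀ a b c d e f → a * d ≤ c * b → c * f ≤ e * d → 0 < d → a * f ≤ e * b
  ratio-trans a b c d e f ad≤cb cf≤ed 0<d = *-cancelʳ-≤ (a * f) (e * b) d {{>-nonZero 0<d}} (begin
    a * f * d   ≡⟨ solve (a ∷ f ∷ d ∷ []) ⟩
    a * d * f   ≤⟨ *-monoˡ-≤ f ad≤cb ⟩
    c * b * f   ≡⟨ solve (c ∷ b ∷ f ∷ []) ⟩
    c * f * b   ≤⟨ *-monoˡ-≤ b cf≤ed ⟩
    e * d * b   ≡⟨ solve (e ∷ d ∷ b ∷ []) ⟩
    e * b * d   ∎)
    where open ≤-Reasoning

  MinimalRatioSubset : Subset → Subset → Subset → Set
  MinimalRatioSubset Y X X′ =
    X′ ⊆ᴹ X × 0 < ∣ X′ ∣ × RatioMinimal Y X′ × ∣ X′ ⊕ Y ∣ * ∣ X ∣ ≤ ∣ X ⊕ Y ∣ * ∣ X′ ∣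

  ¬¬-minimal-ratio-subset : ∀ Y X → 0 < ∣ X ∣ → ¬ ¬ ∃ (MinimalRatioSubset Y X)
  ¬¬-minimal-ratio-subset Y X = go X (wellFounded ∣_∣ <-wellFounded X)
    where
    go : ∀ X → Acc (_<_ on ∣_∣) X → 0 < ∣ X ∣ → ¬ ¬ ∃ (MinimalRatioSubset Y X)
    go X (acc smaller) 0<∣X∣ ¬minimal = ¬¬-excluded-middle λ where
      (no ¬improvable) → ¬minimal (X , id , 0<∣X∣ , ¬improvable⇒minimal ¬improvable , ≤-refl)
      (yes (W , W-improves@(W⊆X , better))) →
        go W (smaller (improves⇒∣W∣<∣X∣ W-improves)) (improves⇒0<∣W∣ W-improves)
          λ (X′ , X′⊆W , 0<∣X′∣ , minimal , X′≼W) → ¬minimal (X′ , W⊆X ∘ X′⊆W , 0<∣X′∣ , minimal ,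
            ratio-trans (∣ X′ ⊕ Y ∣) (∣ X′ ∣) (∣ W ⊕ Y ∣) (∣ W ∣) (∣ X ⊕ Y ∣) (∣ X ∣)
                        X′≼W (<⇒≤ better) (improves⇒0<∣W∣ W-improves))

  -- For X′ ⊆ X minimising K = |X′ + Y| / |X′|, Petridis gives |Y + Y| ≤ |X′ + Y + Y| ≤ K² |X′|,
  -- and K ≤ |X + Y| / |X|.
  ∣X∣*∣Y⊕Y∣≤∣X⊕Y∣² : ∀ X Y → ∣ X ∣ * ∣ Y ⊕ Y ∣ ≤ ∣ X ⊕ Y ∣ * ∣ X ⊕ Y ∣
  ∣X∣*∣Y⊕Y∣≤∣X⊕Y∣² X Y with ∣ X ∣ ≟ 0
  ... | yes ∣X∣≡0 = subst (λ n → n * ∣ Y ⊕ Y ∣ ≤ ∣ X ⊕ Y ∣ * ∣ X ⊕ Y ∣) (sym ∣X∣≡0) z≤n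
  ... | no  ∣X∣≢0 = decidable-stable (_ ≤? _) λ ¬goal →
    ¬¬-minimal-ratio-subset Y X (n≢0⇒n>0 ∣X∣≢0) λ (X′ , X′⊆X , 0<∣X′∣ , minimal , X′≼X) →
      let x′ , x′∈X′ = ∣P∣>0⇒∃∈ X′ 0<∣X′∣
          ∣Y⊕Y∣≤∣X′⊕Y⊕Y∣ = ≤-trans (∣Y∣≤∣X⊕Y∣ X′ (Y ⊕ Y) x′∈X′) (∣∣-mono (⊕-assoc X′ Y Y))
      in ¬goal (square-bound (∣ Y ⊕ Y ∣) (∣ X′ ∣) (∣ X′ ⊕ Y ∣) (∣ X ∣) (∣ X ⊕ Y ∣)
                  (≤-trans (*-monoˡ-≤ ∣ X′ ∣ ∣Y⊕Y∣≤∣X′⊕Y⊕Y∣) (petridis minimal Y)) X′≼X (∣∣-mono X′⊆X) 0<∣X′∣)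
    where
    square-bound : ∀ t n′ s′ n s → t * n′ ≤ s′ * s′ → s′ * n ≤ s * n′ → n′ ≤ n → 0 < n′ → n * t ≤ s * s
    square-bound t n′ s′ n s tn′≤s′² s′n≤sn′ n′≤n 0<n′ =
      *-cancelʳ-≤ (n * t) (s * s) (n′ * n) {{>-nonZero (*-mono-≤ 0<n′ (≤-trans 0<n′ n′≤n))}} (begin
        n * t * (n′ * n)        ≡⟨ solve (n ∷ t ∷ n′ ∷ []) ⟩
        (n * n) * (t * n′)      ≤⟨ *-monoʳ-≤ (n * n) tn′≤s′² ⟩
        (n * n) * (s′ * s′)     ≡⟨ solve (n ∷ s′ ∷ []) ⟩
        (s′ * n) * (s′ * n)     ≤⟨ *-mono-≤ s′n≤sn′ s′n≤sn′ ⟩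
        (s * n′) * (s * n′)     ≡⟨ solve (s ∷ n′ ∷ []) ⟩
        s * s * n′ * n′         ≤⟨ *-monoʳ-≤ (s * s * n′) n′≤n ⟩
        s * s * n′ * n          ≡⟨ solve (s ∷ n′ ∷ n ∷ []) ⟩
        s * s * (n′ * n)        ∎)
      where open ≤-Reasoning

module Counting where

  open import Data.Nat
  open import Data.Nat.Properties
  open import Data.Nat.Induction using (<-wellFounded)
  open import Algebra.Properties.CommutativeSemigroup +-commutativeSemigroup using (xy∙z≈xz∙y)
  open import Data.Product using (_×_; _,_)
  open import Function using (_∘_)
  open import Induction.WellFounded using (Acc; acc)
  open import Relation.Binary.PropositionalEquality
  open import Relation.Nullary using (yes; no)
  open import Defs using (_⊆_; count)
  open FiniteSums

  count≤n : ∀ X n → count X n ≤ n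
  count≤n X zero    = z≤n
  count≤n X (suc n) = begin
    count X n + 𝟙 (X (suc n)) ≤⟨ +-monoʳ-≤ (count X n) (𝟙≤1 (X (suc n))) ⟩
    count X n + 1             ≡⟨ +-comm (count X n) 1 ⟩
    suc (count X n)           ≤⟨ s≤s (count≤n X n) ⟩
    suc n                     ∎
    where open ≤-Reasoning

  count-mono : ∀ {X Y} → X ⊆ Y → ∀ n → count X n ≤ count Y n
  count-mono X⊆Y zero    = z≤n
  count-mono X⊆Y (suc n) = +-mono-≤ (count-mono X⊆Y n) (𝟙-mono (X⊆Y (suc n)))

  count-+ : ∀ X n k → count X (n + k) ≡ count X n + ∑[ i < k ] 𝟙 (X (suc (n + i)))
  count-+ X n zero    = trans (cong (count X) (+-identityʳ n)) (sym (+-identityʳ (count X n)))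
  count-+ X n (suc k) rewrite +-suc n k | count-+ X n k = +-assoc (count X n) _ _

  module _ (M : ℕ) .{{_ : NonZero M}} where

    open Residues M using (∣_∣)

    count-+period : ∀ {X R T} → (∀ {x} → T ≤ x → X x ≡ R (x % M)) →
                    ∀ {n} → T ≤ n → count X (n + M) ≡ count X n + ∣ R ∣
    count-+period {X} {R} {T} periodic {n} T≤n = begin
      count X (n + M)                                 ≡⟨ count-+ X n M ⟩
      count X n + ∑[ i < M ] 𝟙 (X (suc (n + i)))      ≡⟨ cong (count X n +_) (∑-cong M (λ {i} _ →
                                                           cong 𝟙 (periodic (≤-trans T≤n (≤-trans (m≤m+n n i) (n≤1+n _)))))) ⟩
      count X n + ∑[ i < M ] 𝟙 (R (suc (n + i) % M))  ≡⟨ cong (count X n +_) (∑-cong M (λ {i} _ →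
                                                           cong (λ x → 𝟙 (R (x % M))) (trans (cong suc (+-comm n i)) (sym (+-suc i n))))) ⟩
      count X n + ∑[ i < M ] 𝟙 (R ((i + suc n) % M))  ≡⟨ cong (count X n +_) (∑-rotate M (𝟙 ∘ R) (suc n)) ⟩
      count X n + ∣ R ∣                               ∎
      where open ≡-Reasoning

    linear-growth : ∀ (f : ℕ → ℕ) r T → (∀ n → f n ≤ n) → r ≤ M → (∀ {n} → T ≤ n → f (n + M) ≡ f n + r) →
                    ∀ n → M * f n ≤ n * r + M * (T + M) × n * r ≤ M * f n + M * (T + M)
    linear-growth f r T f≤id r≤M step n = bounds n (<-wellFounded n)
      where
      K : ℕ
      K = M * (T + M)

      Bounds : ℕ → Set
      Bounds n = M * f n ≤ n * r + K × n * r ≤ M * f n + K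

      next-period : ∀ {m} → T ≤ m → Bounds m → Bounds (m + M)
      next-period {m} T≤m (upper , lower) rewrite step T≤m = (begin
        M * (f m + r)        ≡⟨ *-distribˡ-+ M (f m) r ⟩
        M * f m + M * r      ≤⟨ +-monoˡ-≤ (M * r) upper ⟩
        m * r + K + M * r    ≡⟨ xy∙z≈xz∙y (m * r) K (M * r) ⟩
        m * r + M * r + K    ≡⟨ cong (_+ K) (*-distribʳ-+ r m M) ⟨
        (m + M) * r + K      ∎) , (begin
        (m + M) * r          ≡⟨ *-distribʳ-+ r m M ⟩
        m * r + M * r        ≤⟨ +-monoˡ-≤ (M * r) lower ⟩
        M * f m + K + M * r  ≡⟨ xy∙z≈xz∙y (M * f m) K (M * r) ⟩
        M * f m + M * r + K  ≡⟨ cong (_+ K) (*-distribˡ-+ M (f m) r) ⟨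
        M * (f m + r) + K    ∎)
        where open ≤-Reasoning

      bounds : ∀ n → Acc _<_ n → Bounds n
      bounds n (acc smaller) with n <? T + M
      ... | yes n<T+M = (begin
            M * f n      ≤⟨ *-monoʳ-≤ M (f≤id n) ⟩
            M * n        ≤⟨ *-monoʳ-≤ M (<⇒≤ n<T+M) ⟩
            K            ≤⟨ m≤n+m K (n * r) ⟩
            n * r + K    ∎) , (begin
            n * r        ≤⟨ *-monoʳ-≤ n r≤M ⟩
            n * M        ≤⟨ *-monoˡ-≤ M (<⇒≤ n<T+M) ⟩
            (T + M) * M  ≡⟨ *-comm (T + M) M ⟩
            K            ≤⟨ m≤n+m K (M * f n) ⟩
            M * f n + K  ∎)
        where open ≤-Reasoning
      ... | no n≮T+M = subst Bounds (m∸n+n≡m M≤n)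
                         (next-period T≤n∸M (bounds (n ∸ M) (smaller (∸-monoʳ-< (>-nonZero⁻¹ M) M≤n))))
        where
        M≤n : M ≤ n
        M≤n = ≤-trans (m≤n+m M T) (≮⇒≥ n≮T+M)
        T≤n∸M : T ≤ n ∸ M
        T≤n∸M = ≤-trans (≤-reflexive (sym (m+n∸n≡m T M))) (∸-monoˡ-≤ M (≮⇒≥ n≮T+M))

    periodic-count-bounds : ∀ {X R T} → (∀ {x} → T ≤ x → X x ≡ R (x % M)) → ∀ n →
                            M * count X n ≤ n * ∣ R ∣ + M * (T + M) × n * ∣ R ∣ ≤ M * count X n + M * (T + M)
    periodic-count-bounds {X} {R} {T} periodic =
      linear-growth (count X) ∣ R ∣ T (count≤n X) (Residues.∣P∣≤M M R) (count-+period periodic)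

module Asymptotics where

  open import Data.Nat using (ℕ; _≤_; _⊔_)
  open import Data.Nat.Properties using (m⊔n≤o⇒m≤o; m⊔n≤o⇒n≤o; m≤m⊔n; m≤n⊔m)
  open import Data.Product using (∃; _×_; _,_)

  Eventually : (ℕ → Set) → Set
  Eventually P = ∃ λ N → ∀ n → N ≤ n → P n

  Frequently : (ℕ → Set) → Set
  Frequently P = ∀ N → ∃ λ n → N ≤ n × P n

  eventually-∧ : ∀ {P Q} → Eventually P → Eventually Q → Eventually (λ n → P n × Q n)
  eventually-∧ (N₁ , P-from-N₁) (N₂ , Q-from-N₂) =
    N₁ ⊔ N₂ , λ n N≤n → P-from-N₁ n (m⊔n≤o⇒m≤o N₁ N₂ N≤n) , Q-from-N₂ n (m⊔n≤o⇒n≤o N₁ N₂ N≤n)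

  frequently-∧ : ∀ {P Q} → Frequently P → Eventually Q → Frequently (λ n → P n × Q n)
  frequently-∧ P-often (N , Q-from-N) M with n , N⊔M≤n , Pn ← P-often (N ⊔ M) =
    n , m⊔n≤o⇒n≤o N M N⊔M≤n , Pn , Q-from-N n (m⊔n≤o⇒m≤o N M N⊔M≤n)

  eventually⇒frequently : ∀ {P} → Eventually P → Frequently P
  eventually⇒frequently (N , P-from-N) M = N ⊔ M , m≤n⊔m N M , P-from-N (N ⊔ M) (m≤m⊔n N M)

module RationalSequences where

  open import Data.Nat as ℕ using (ℕ; suc)
  import Data.Nat.Properties as ℕ
  open import Data.Integer as ℤ using (+_; +[1+_]; -[1+_]; +0)
  import Data.Integer.Properties as ℤ
  open import Data.Rational
  open import Data.Rational.Properties
  open import Data.Rational.Solver using (module +-*-Solver)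
  import Data.Rational.Unnormalised as ℚᵘ
  import Data.Rational.Unnormalised.Properties as ℚᵘ
  open import Data.Product using (∃; ∃₂; _×_; _,_; proj₁; proj₂)
  open import Data.Sum using (inj₁; inj₂)
  open import Data.List using (_∷_; [])
  open import Data.Nat.Tactic.RingSolver using () renaming (solve to solveℕ)
  open import Relation.Binary.PropositionalEquality
  open import Relation.Nullary.Decidable using (decidable-stable)
  open +-*-Solver using (solve; _:+_; _:*_; _:-_; :-_; _:=_; con)
  open Asymptotics

  p-q<ε⇒p<q+ε : ∀ {p q ε} → p - q < ε → p < q + ε
  p-q<ε⇒p<q+ε {p} {q} {ε} p-q<ε = subst₂ _<_ (solve 2 (λ p q → p :- q :+ q := p) refl p q) (+-comm ε q) (+-monoˡ-< q p-q<ε)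

  p<q+ε⇒p-q<ε : ∀ {p q ε} → p < q + ε → p - q < ε
  p<q+ε⇒p-q<ε {p} {q} {ε} p<q+ε = subst (p - q <_) (solve 2 (λ q ε → q :+ ε :- q := ε) refl q ε) (+-monoˡ-< (- q) p<q+ε)

  -[p-q]≡q-p : ∀ p q → - (p - q) ≡ q - p
  -[p-q]≡q-p = solve 2 (λ p q → :- (p :- q) := q :- p) refl

  ∣p-q∣≡∣q-p∣ : ∀ p q → ∣ p - q ∣ ≡ ∣ q - p ∣
  ∣p-q∣≡∣q-p∣ p q = trans (sym (∣-p∣≡∣p∣ (p - q))) (cong ∣_∣ (-[p-q]≡q-p p q))

  p<p+ε : ∀ p {ε} → 0ℚ < ε → p < p + ε
  p<p+ε p {ε} 0<ε = subst (_< p + ε) (+-identityʳ p) (+-monoʳ-< p 0<ε)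

  +-cancelʳ-< : ∀ {p q} r → p + r < q + r → p < q
  +-cancelʳ-< {p} {q} r p+r<q+r = subst₂ _<_ (cancel p r) (cancel q r) (+-monoˡ-< (- r) p+r<q+r)
    where
    cancel : ∀ p r → p + r - r ≡ p
    cancel = solve 2 (λ p r → p :+ r :- r := p) refl

  p≤∣p∣ : ∀ p → p ≤ ∣ p ∣
  p≤∣p∣ p with ∣p∣≡p∨∣p∣≡-p p
  ... | inj₁ ∣p∣≡p  = ≤-reflexive (sym ∣p∣≡p)
  ... | inj₂ ∣p∣≡-p = ≤-trans (subst (_≤ 0ℚ) (solve 1 (λ p → :- (:- p) := p) refl p)
                                (neg-antimono-≤ (subst (0ℚ ≤_) ∣p∣≡-p (0≤∣p∣ p))))
                              (0≤∣p∣ p)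

  ∣x-q∣<ε⇒x<q+ε : ∀ {x q ε} → ∣ x - q ∣ < ε → x < q + ε
  ∣x-q∣<ε⇒x<q+ε {x} {q} ∣x-q∣<ε = p-q<ε⇒p<q+ε (≤-<-trans (p≤∣p∣ (x - q)) ∣x-q∣<ε)

  ∣x-q∣<ε⇒q<x+ε : ∀ {x q ε} → ∣ x - q ∣ < ε → q < x + ε
  ∣x-q∣<ε⇒q<x+ε {x} {q} {ε} ∣x-q∣<ε = ∣x-q∣<ε⇒x<q+ε (subst (_< ε) (∣p-q∣≡∣q-p∣ x q) ∣x-q∣<ε)

  x<q+ε∧q<x+ε⇒∣x-q∣<ε : ∀ {x q ε} → x < q + ε → q < x + ε → ∣ x - q ∣ < ε
  x<q+ε∧q<x+ε⇒∣x-q∣<ε {x} {q} x<q+ε q<x+ε with ∣p∣≡p∨∣p∣≡-p (x - q)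
  ... | inj₁ ∣x-q∣≡x-q  = subst (_< _) (sym ∣x-q∣≡x-q) (p<q+ε⇒p-q<ε x<q+ε)
  ... | inj₂ ∣x-q∣≡q-x = subst (_< _) (sym (trans ∣x-q∣≡q-x (-[p-q]≡q-p x q))) (p<q+ε⇒p-q<ε q<x+ε)

  p<q⇒0<q-p : ∀ {p q} → p < q → 0ℚ < q - p
  p<q⇒0<q-p {p} {q} p<q = subst (_< q - p) (+-inverseʳ p) (+-monoˡ-< (- p) p<q)

  infix 4 _⟶_
  _⟶_ : (ℕ → ℚ) → ℚ → Set
  u ⟶ q = ∀ ε → 0ℚ < ε → Eventually (λ n → ∣ u n - q ∣ < ε)

  Cauchy : (ℕ → ℚ) → Set
  Cauchy u = ∀ ε → 0ℚ < ε → ∃ λ N → ∀ m n → N ℕ.≤ m → N ℕ.≤ n → ∣ u m - u n ∣ < ε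

  ⟶-const : ∀ x → (λ _ → x) ⟶ x
  ⟶-const x ε 0<ε = 0 , λ _ _ → subst (λ d → ∣ d ∣ < ε) (sym (+-inverseʳ x)) 0<ε

  ⟶⇒eventually-> : ∀ {u p r} → u ⟶ p → r < p → Eventually (λ n → r < u n)
  ⟶⇒eventually-> {u} {p} {r} u⟶p r<p with N , close ← u⟶p (p - r) (p<q⇒0<q-p r<p) =
    N , λ n N≤n → subst₂ _<_ (solve 2 (λ p r → p :+ (r :- p) := r) refl p r)
                              (solve 3 (λ x p r → x :+ (p :- r) :+ (r :- p) := x) refl (u n) p r)
                              (+-monoˡ-< (r - p) (∣x-q∣<ε⇒q<x+ε {u n} {p} (close n N≤n)))

  ⟶⇒eventually-< : ∀ {u p r} → u ⟶ p → p < r → Eventually (λ n → u n < r)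
  ⟶⇒eventually-< {u} {p} {r} u⟶p p<r with N , close ← u⟶p (r - p) (p<q⇒0<q-p p<r) =
    N , λ n N≤n → subst (u n <_) (solve 2 (λ p r → p :+ (r :- p) := r) refl p r) (∣x-q∣<ε⇒x<q+ε {u n} {p} (close n N≤n))

  ⟶-mono : ∀ {u v p q} → u ⟶ p → v ⟶ q → Frequently (λ n → u n ≤ v n) → p ≤ q
  ⟶-mono {u} {v} {p} {q} u⟶p v⟶q u≤v-often = decidable-stable (p ≤? q) λ p≰q →
    let r , q<r , r<p = <-dense (≰⇒> p≰q)
        n , _ , un≤vn , r<un , vn<r = frequently-∧ u≤v-often
                                        (eventually-∧ (⟶⇒eventually-> {u} u⟶p r<p) (⟶⇒eventually-< {v} v⟶q q<r)) 0
    in <-irrefl refl (<-trans r<un (≤-<-trans un≤vn vn<r))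

  ⟶-unique : ∀ {u p q} → u ⟶ p → u ⟶ q → p ≡ q
  ⟶-unique {u} u⟶p u⟶q = ≤-antisym (⟶-mono {u} {u} u⟶p u⟶q always) (⟶-mono {u} {u} u⟶q u⟶p always)
    where
    always : Frequently (λ n → u n ≤ u n)
    always N = N , ℕ.≤-refl , ≤-refl

  toℚᵘ-/ : ∀ a d → toℚᵘ (+ a / suc d) ℚᵘ.≃ ℚᵘ.mkℚᵘ (+ a) d
  toℚᵘ-/ a d = toℚᵘ-fromℚᵘ (ℚᵘ.mkℚᵘ (+ a) d)

  /-mono-≤ : ∀ a d b e → a ℕ.* suc e ℕ.≤ b ℕ.* suc d → + a / suc d ≤ + b / suc e
  /-mono-≤ a d b e ae≤bd = toℚᵘ-cancel-≤ (ℚᵘ.≤-respˡ-≃ (ℚᵘ.≃-sym (toℚᵘ-/ a d)) (ℚᵘ.≤-respʳ-≃ (ℚᵘ.≃-sym (toℚᵘ-/ b e))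
    (ℚᵘ.*≤* (subst₂ ℤ._≤_ (ℤ.pos-* a (suc e)) (ℤ.pos-* b (suc d)) (ℤ.+≤+ ae≤bd)))))

  /-+ : ∀ a d b e → + a / suc d + + b / suc e ≡ + (a ℕ.* suc e ℕ.+ b ℕ.* suc d) / (suc d ℕ.* suc e)
  /-+ a d b e = toℚᵘ-injective (ℚᵘ.≃-trans (toℚᵘ-homo-+ (+ a / suc d) (+ b / suc e))
    (ℚᵘ.≃-trans (ℚᵘ.+-cong (toℚᵘ-/ a d) (toℚᵘ-/ b e))
    (ℚᵘ.≃-trans (ℚᵘ.≃-reflexive (cong (λ z → ℚᵘ.mkℚᵘ z (e ℕ.+ d ℕ.* suc e)) numerator))
    (ℚᵘ.≃-sym (toℚᵘ-/ _ _)))))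
    where
    numerator : + a ℤ.* + suc e ℤ.+ + b ℤ.* + suc d ≡ + (a ℕ.* suc e ℕ.+ b ℕ.* suc d)
    numerator = trans (cong₂ ℤ._+_ (sym (ℤ.pos-* a (suc e))) (sym (ℤ.pos-* b (suc d)))) (sym (ℤ.pos-+ (a ℕ.* suc e) (b ℕ.* suc d)))

  /-* : ∀ a d b e → + a / suc d * (+ b / suc e) ≡ + (a ℕ.* b) / (suc d ℕ.* suc e)
  /-* a d b e = toℚᵘ-injective (ℚᵘ.≃-trans (toℚᵘ-homo-* (+ a / suc d) (+ b / suc e))
    (ℚᵘ.≃-trans (ℚᵘ.*-cong (toℚᵘ-/ a d) (toℚᵘ-/ b e))
    (ℚᵘ.≃-trans (ℚᵘ.≃-reflexive (cong (λ z → ℚᵘ.mkℚᵘ z (e ℕ.+ d ℕ.* suc e)) (sym (ℤ.pos-* a b))))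
    (ℚᵘ.≃-sym (toℚᵘ-/ _ _)))))

  0≤/ : ∀ a d → 0ℚ ≤ + a / suc d
  0≤/ a d = /-mono-≤ 0 0 a d ℕ.z≤n

  K/[1+n]⟶0 : ∀ K ε → 0ℚ < ε → Eventually (λ n → + K / suc n < ε)
  K/[1+n]⟶0 K ε@(mkℚ +[1+ p ] d _) _ = K ℕ.* suc d , λ n Kd≤n →
    toℚᵘ-cancel-< (ℚᵘ.<-respˡ-≃ (ℚᵘ.≃-sym (toℚᵘ-/ K n)) (ℚᵘ.*<* (subst₂ ℤ._<_ (ℤ.pos-* K (suc d)) (ℤ.pos-* (suc p) (suc n))
      (ℤ.+<+ (ℕ.≤-trans (ℕ.s≤s Kd≤n) (ℕ.m≤n*m (suc n) (suc p)))))))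
  K/[1+n]⟶0 K (mkℚ +0       _ _) (*<* (ℤ.+<+ ()))
  K/[1+n]⟶0 K (mkℚ -[1+ _ ] _ _) (*<* ())

  Mc≤Nr+MK⇒c/N≤r/M+K/N : ∀ c n r m K → suc m ℕ.* c ℕ.≤ suc n ℕ.* r ℕ.+ suc m ℕ.* K →
                          + c / suc n ≤ + r / suc m + + K / suc n
  Mc≤Nr+MK⇒c/N≤r/M+K/N c n r m K Mc≤Nr+MK rewrite /-+ r m K n =
    /-mono-≤ c n (r ℕ.* suc n ℕ.+ K ℕ.* suc m) (n ℕ.+ m ℕ.* suc n) (begin
      c ℕ.* (suc m ℕ.* suc n)                 ≡⟨ solveℕ (c ∷ m ∷ n ∷ []) ⟩
      suc m ℕ.* c ℕ.* suc n                   ≤⟨ ℕ.*-monoˡ-≤ (suc n) Mc≤Nr+MK ⟩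
      (suc n ℕ.* r ℕ.+ suc m ℕ.* K) ℕ.* suc n ≡⟨ solveℕ (r ∷ K ∷ m ∷ n ∷ []) ⟩
      (r ℕ.* suc n ℕ.+ K ℕ.* suc m) ℕ.* suc n ∎)
    where open ℕ.≤-Reasoning

  Nr≤Mc+MK⇒r/M≤c/N+K/N : ∀ c n r m K → suc n ℕ.* r ℕ.≤ suc m ℕ.* c ℕ.+ suc m ℕ.* K →
                          + r / suc m ≤ + c / suc n + + K / suc n
  Nr≤Mc+MK⇒r/M≤c/N+K/N c n r m K Nr≤Mc+MK rewrite /-+ c n K n =
    /-mono-≤ r m (c ℕ.* suc n ℕ.+ K ℕ.* suc n) (n ℕ.+ n ℕ.* suc n) (begin
      r ℕ.* (suc n ℕ.* suc n)                 ≡⟨ solveℕ (r ∷ n ∷ []) ⟩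
      suc n ℕ.* r ℕ.* suc n                   ≤⟨ ℕ.*-monoˡ-≤ (suc n) Nr≤Mc+MK ⟩
      (suc m ℕ.* c ℕ.+ suc m ℕ.* K) ℕ.* suc n ≡⟨ solveℕ (c ∷ K ∷ m ∷ n ∷ []) ⟩
      (c ℕ.* suc n ℕ.+ K ℕ.* suc n) ℕ.* suc m ∎)
    where open ℕ.≤-Reasoning

  third : ∀ ε → 0ℚ < ε → ∃ λ δ → 0ℚ < δ × δ + δ + δ ≡ ε
  third ε 0<ε = ε * ⅓ , subst (_< ε * ⅓) (*-zeroˡ ⅓) (*-monoˡ-<-pos ⅓ 0<ε) ,
                solve 1 (λ ε → ε :* con ⅓ :+ ε :* con ⅓ :+ ε :* con ⅓ := ε) refl ε
    where
    ⅓ : ℚ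
    ⅓ = + 1 / 3

  squeeze⇒cauchy : ∀ {u} → (∀ ε → 0ℚ < ε → ∃₂ λ l h → ∃₂ λ p q →
                     l ⟶ p × h ⟶ q × q - p < ε × (∀ n → l n ≤ u n × u n ≤ h n)) → Cauchy u
  squeeze⇒cauchy {u} squeeze ε 0<ε =
    let δ , 0<δ , 3δ≡ε = third ε 0<ε
        l , h , p , q , l⟶p , h⟶q , q-p<δ , l≤u≤h = squeeze δ 0<δ
        N , close = eventually-∧ (l⟶p δ 0<δ) (h⟶q δ 0<δ)
        below : ∀ {m n} → N ℕ.≤ m → N ℕ.≤ n → u m < u n + ε
        below {m} {n} N≤m N≤n = begin-strict
          u m                  ≤⟨ proj₂ (l≤u≤h m) ⟩
          h m                  <⟨ ∣x-q∣<ε⇒x<q+ε {h m} {q} (proj₂ (close m N≤m)) ⟩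
          q + δ                <⟨ +-monoˡ-< δ (p-q<ε⇒p<q+ε {q} {p} q-p<δ) ⟩
          p + δ + δ            <⟨ +-monoˡ-< δ (+-monoˡ-< δ (∣x-q∣<ε⇒q<x+ε {l n} {p} (proj₁ (close n N≤n)))) ⟩
          l n + δ + δ + δ      ≤⟨ +-monoˡ-≤ δ (+-monoˡ-≤ δ (+-monoˡ-≤ δ (proj₁ (l≤u≤h n)))) ⟩
          u n + δ + δ + δ      ≡⟨ solve 2 (λ x δ → x :+ δ :+ δ :+ δ := x :+ (δ :+ δ :+ δ)) refl (u n) δ ⟩
          u n + (δ + δ + δ)    ≡⟨ cong (λ x → u n + x) 3δ≡ε ⟩
          u n + ε              ∎
    in N , λ m n N≤m N≤n → x<q+ε∧q<x+ε⇒∣x-q∣<ε (below N≤m N≤n) (below N≤n N≤m)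
    where open ≤-Reasoning

module Densities where

  open import Data.Nat as ℕ using (suc; _%_)
  import Data.Nat.Properties as ℕ
  open import Data.Integer using (+_)
  open import Data.Rational
  open import Data.Rational.Properties
  open import Data.Product using (_,_)
  open import Relation.Binary.PropositionalEquality
  open import Defs using (_⊆_; count; ratio; HasDensityℚ)
  open Asymptotics
  open RationalSequences
  open Counting

  ratio-mono : ∀ {X Y} → X ⊆ Y → ∀ n → ratio X n ≤ ratio Y n
  ratio-mono {X} {Y} X⊆Y n = /-mono-≤ (count X (suc n)) n (count Y (suc n)) n (ℕ.*-monoˡ-≤ (suc n) (count-mono X⊆Y (suc n)))

  periodic-density : ∀ m {X R T} → (∀ {x} → T ℕ.≤ x → X x ≡ R (x % suc m)) →
                     HasDensityℚ X (+ Residues.∣_∣ (suc m) R / suc m)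
  periodic-density m {X} {R} {T} periodic ε 0<ε =
    let N , K/[1+n]<ε = K/[1+n]⟶0 K ε 0<ε
    in N , λ n N≤n →
      let upper , lower = periodic-count-bounds (suc m) periodic (suc n)
      in x<q+ε∧q<x+ε⇒∣x-q∣<ε
           (≤-<-trans (Mc≤Nr+MK⇒c/N≤r/M+K/N (count X (suc n)) n ∣R∣ m K upper) (+-monoʳ-< (+ ∣R∣ / suc m) (K/[1+n]<ε n N≤n)))
           (≤-<-trans (Nr≤Mc+MK⇒r/M≤c/N+K/N (count X (suc n)) n ∣R∣ m K lower) (+-monoʳ-< (ratio X n) (K/[1+n]<ε n N≤n)))
    where
    K ∣R∣ : ℕ
    K = T ℕ.+ suc m
    ∣R∣ = Residues.∣_∣ (suc m) R

  frequently-below⇒≤density : ∀ {x X Y q} → Frequently (λ n → x < ratio X n) → X ⊆ Y → HasDensityℚ Y q → x ≤ q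
  frequently-below⇒≤density {x} {X} {Y} x<ratio-often X⊆Y Y→q =
    ⟶-mono {λ _ → x} {ratio Y} (⟶-const x) Y→q λ N → let n , N≤n , x<ratio = x<ratio-often N in
      n , N≤n , ≤-trans (<⇒≤ x<ratio) (ratio-mono X⊆Y n)

  frequently-above⇒density≤ : ∀ {x X Y q} → Frequently (λ n → ratio Y n < x) → X ⊆ Y → HasDensityℚ X q → q ≤ x
  frequently-above⇒density≤ {x} {X} {Y} ratio<x-often X⊆Y X→q =
    ⟶-mono {ratio X} {λ _ → x} X→q (⟶-const x) λ N → let n , N≤n , ratio<x = ratio<x-often N in
      n , N≤n , ≤-trans (ratio-mono X⊆Y n) (<⇒≤ ratio<x)

module ArithmeticProgressions where

  open import Data.Bool.Properties using (⇔→≡)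
  open import Data.List using (List; []; _∷_)
  open import Data.List.Relation.Unary.Any using (Any; here; there)
  open import Data.Nat
  open import Data.Nat.Properties
  open import Data.Nat.DivMod
  open import Data.Nat.Divisibility using (_∣_; ∣-trans; ∣-refl; m∣m*n; n∣m*n; m%n≡0⇒n∣m; quotient; m∣n⇒n≡m*quotient)
  open import Data.Product using (∃; _×_; _,_; proj₁; proj₂)
  open import Function using (mk⇔)
  open import Relation.Binary.PropositionalEquality
  open import Relation.Nullary using (contradiction)
  open import Defs using (_∈_; InAP; InZ)

  period : List (ℕ × ℕ) → ℕ
  period []                 = 1
  period ((_ , zero)  ∷ ps) = period ps
  period ((_ , suc k) ∷ ps) = suc k * period ps

  period≡suc : ∀ ps → ∃ λ m → period ps ≡ suc m
  period≡suc []                 = 0 , refl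
  period≡suc ((_ , zero)  ∷ ps) = period≡suc ps
  period≡suc ((_ , suc k) ∷ ps) with m , period≡1+m ← period≡suc ps rewrite period≡1+m = m + k * suc m , refl

  threshold : List (ℕ × ℕ) → ℕ
  threshold []             = 0
  threshold ((a , _) ∷ ps) = suc a + threshold ps

  ∈AP-resp : ∀ M .{{_ : NonZero M}} {x y a k} → suc k ∣ M → a ≤ y → x % M ≡ y % M →
             InAP x (a , suc k) → InAP y (a , suc k)
  ∈AP-resp M {x} {y} {a} {k} k∣M a≤y x≡y (j , x≡a+kj) = quotient k∣y∸a , (begin
    y                                ≡⟨ m+[n∸m]≡n a≤y ⟨
    a + (y ∸ a)                      ≡⟨ cong (a +_) (m∣n⇒n≡m*quotient k∣y∸a) ⟩
    a + suc k * quotient k∣y∸a       ∎)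
    where
    open ≡-Reasoning
    open Residues (suc k) using (_≡ᴹ_; +-cancelʳ-≡ᴹ)
    x≡ᴷa : x ≡ᴹ a
    x≡ᴷa = trans (cong (_% suc k) (trans x≡a+kj (cong (a +_) (*-comm (suc k) j)))) ([m+kn]%n≡m%n a j (suc k))
    y≡ᴷx : y ≡ᴹ x
    y≡ᴷx = begin
      y % suc k         ≡⟨ m∣n⇒o%n%m≡o%m (suc k) M y k∣M ⟨
      y % M % suc k     ≡⟨ cong (_% suc k) x≡y ⟨
      x % M % suc k     ≡⟨ m∣n⇒o%n%m≡o%m (suc k) M x k∣M ⟩
      x % suc k         ∎
    k∣y∸a : suc k ∣ y ∸ a
    k∣y∸a = m%n≡0⇒n∣m (y ∸ a) (suc k)
              (+-cancelʳ-≡ᴹ {y ∸ a} {0} a (trans (cong (_% suc k) (m∸n+n≡m a≤y)) (trans y≡ᴷx x≡ᴷa)))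

  ∈progressions-resp : ∀ M .{{_ : NonZero M}} ps {x y} → period ps ∣ M → threshold ps ≤ x → threshold ps ≤ y →
                       x % M ≡ y % M → Any (InAP x) ps → Any (InAP y) ps
  ∈progressions-resp M ((a , zero) ∷ ps) _ T≤x _ _ (here (_ , x≡a+0)) =
    contradiction (subst (suc a ≤_) (trans x≡a+0 (+-identityʳ a)) (≤-trans (m≤m+n (suc a) _) T≤x)) (n≮n a)
  ∈progressions-resp M ((a , suc k) ∷ ps) period∣M _ T≤y x≡y (here x∈AP) =
    here (∈AP-resp M (∣-trans (m∣m*n {suc k} (period ps)) period∣M) (≤-trans (m≤n+m a 1) (≤-trans (m≤m+n (suc a) _) T≤y)) x≡y x∈AP)
  ∈progressions-resp M ((a , zero) ∷ ps) period∣M T≤x T≤y x≡y (there x∈ps) =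
    there (∈progressions-resp M ps period∣M (≤-trans (m≤n+m _ (suc a)) T≤x) (≤-trans (m≤n+m _ (suc a)) T≤y) x≡y x∈ps)
  ∈progressions-resp M ((a , suc k) ∷ ps) period∣M T≤x T≤y x≡y (there x∈ps) =
    there (∈progressions-resp M ps (∣-trans (n∣m*n (suc k)) period∣M) (≤-trans (m≤n+m _ (suc a)) T≤x)
             (≤-trans (m≤n+m _ (suc a)) T≤y) x≡y x∈ps)

  InZ⇒eventually-periodic : ∀ {B} → InZ B → ∃ λ m → ∃ λ T → ∀ {x} → T ≤ x → B x ≡ B (x % suc m + T * suc m)
  InZ⇒eventually-periodic {B} (ps , B≡⋃ps) = let m , period≡1+m = period≡suc ps in m , T , periodic m period≡1+m
    where
    T : ℕ
    T = threshold ps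

    periodic : ∀ m → period ps ≡ suc m → ∀ {x} → T ≤ x → B x ≡ B (x % suc m + T * suc m)
    periodic m period≡1+m {x} T≤x = ⇔→≡ (mk⇔ (transfer T≤x T≤y x≡y) (transfer T≤y T≤x (sym x≡y)))
      where
      M : ℕ
      M = suc m
      T≤y : T ≤ x % M + T * M
      T≤y = ≤-trans (m≤m*n T M) (m≤n+m (T * M) (x % M))
      x≡y : x % M ≡ (x % M + T * M) % M
      x≡y = sym (trans ([m+kn]%n≡m%n (x % M) T M) (m%n%n≡m%n x M))
      transfer : ∀ {x y} → T ≤ x → T ≤ y → x % M ≡ y % M → x ∈ B → y ∈ B
      transfer T≤x T≤y x≡y x∈B = proj₂ (B≡⋃ps _) (∈progressions-resp M ps (subst (_∣ M) (sym period≡1+m) ∣-refl)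
                                    T≤x T≤y x≡y (proj₁ (B≡⋃ps _) x∈B))

module Sumsets where

  open import Data.Nat
  open import Data.Product using (∃; _×_; _,_)
  open import Defs using (_∈_; sumset)
  open BoundedSearch

  ∈-sumset⁺ : ∀ A {i n} → i ≤ n → i ∈ A → (n ∸ i) ∈ A → n ∈ sumset A
  ∈-sumset⁺ A i≤n i∈A n∸i∈A = T⇒≡ (∃<⇒any _ (s≤s i≤n) (T-∧⁺ (≡⇒T i∈A) (≡⇒T n∸i∈A)))

  ∈-sumset⁻ : ∀ A {n} → n ∈ sumset A → ∃ λ i → i ≤ n × i ∈ A × (n ∸ i) ∈ A
  ∈-sumset⁻ A n∈A+A with i , i<1+n , i∈A∧n∸i∈A ← any⇒∃< _ (≡⇒T n∈A+A) with i∈A , n∸i∈A ← T-∧⁻ i∈A∧n∸i∈A =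
    i , s≤s⁻¹ i<1+n , T⇒≡ i∈A , T⇒≡ n∸i∈A

module ResidueModel (M : ℕ) .{{_ : NonZero M}} (A R : Subset) (T : ℕ)
                    (beyond-T-R⊆A : Residues._⊆ᴹ_beyond_ M R A T)
                    (occurs? : ∀ r → Dec (Residues.OccursIn M A r)) where

  open import Data.Bool using (_∧_)
  open import Data.Nat
  open import Data.Nat.Properties
  open import Data.Nat.DivMod
  open import Data.Product using (_×_; _,_; proj₁; proj₂)
  open import Relation.Binary.PropositionalEquality
  open import Relation.Nullary using (yes; no; does)
  open import Relation.Nullary.Decidable using (dec-true)
  open import Defs using (_∈_; _⊆_; sumset)
  open FiniteSums using (∑<; term≤∑)
  open BoundedSearch using (T⇒≡; ≡⇒T; T-∧⁻)
  open Sumsets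

  open Residues M

  Y : Subset
  Y r = does (occurs? r)

  ∈A⇒∈ᴹY : ∀ {x} → x ∈ A → x ∈ᴹ Y
  ∈A⇒∈ᴹY {x} x∈A = dec-true (occurs? (x % M)) (x , x∈A , sym (%-≡ᴹ x))

  witness : ℕ → ℕ
  witness r with occurs? r
  ... | yes (x , _) = x
  ... | no  _       = 0

  witness-occurs : ∀ {r} → r ∈ Y → witness r ∈ A × witness r ≡ᴹ r
  witness-occurs {r} r∈Y with occurs? r
  ... | yes (_ , x∈A , x≡r) = x∈A , x≡r

  L : ℕ
  L = ∑< M witness

  sumset⊆ᴹY⊕Y : ∀ {x} → x ∈ sumset A → x ∈ᴹ Y ⊕ Y
  sumset⊆ᴹY⊕Y x∈A+A with i , i≤x , i∈A , x∸i∈A ← ∈-sumset⁻ A x∈A+A =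
    ∈ᴹ-resp (Y ⊕ Y) (cong (_% M) (m+[n∸m]≡n i≤x)) (∈-⊕⁺ Y Y (∈A⇒∈ᴹY i∈A) (∈A⇒∈ᴹY x∸i∈A))

  -- The witness w of q's residue class is at most L, so x ∸ w ≥ T lies in the residue class of p, hence in A.
  R+Y⊆sumset : ∀ {x p q} → T + L ≤ x → p ∈ᴹ R → q ∈ᴹ Y → p + q ≡ᴹ x → x ∈ sumset A
  R+Y⊆sumset {x} {p} {q} T+L≤x p∈R q∈Y p+q≡x = ∈-sumset⁺ A w≤x w∈A (beyond-T-R⊆A T≤x∸w x∸w∈R)
    where
    w : ℕ
    w = witness (q % M)
    w∈A : w ∈ A
    w∈A = proj₁ (witness-occurs q∈Y)
    w≡q : w ≡ᴹ q
    w≡q = trans (proj₂ (witness-occurs q∈Y)) (%-≡ᴹ q)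
    w≤L : w ≤ L
    w≤L = term≤∑ M witness (m%n<n q M)
    w≤x : w ≤ x
    w≤x = ≤-trans w≤L (≤-trans (m≤n+m L T) T+L≤x)
    T≤x∸w : T ≤ x ∸ w
    T≤x∸w = ≤-trans (≤-reflexive (sym (m+n∸n≡m T L))) (≤-trans (∸-monoˡ-≤ L T+L≤x) (∸-monoʳ-≤ x w≤L))
    x∸w∈R : (x ∸ w) ∈ᴹ R
    x∸w∈R = ∈ᴹ-resp R (sym (+-cancelʳ-≡ᴹ w (begin
      (x ∸ w + w) % M   ≡⟨ cong (_% M) (m∸n+n≡m w≤x) ⟩
      x % M             ≡⟨ p+q≡x ⟨
      (p + q) % M       ≡⟨ +-congᴹ {p} refl (sym w≡q) ⟩
      (p + w) % M       ∎))) p∈R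
      where open ≡-Reasoning

  upper-model lower-model : Subset
  upper-model x = (Y ⊕ Y) (x % M)
  lower-model x = (T + L ≤ᵇ x) ∧ (R ⊕ Y) (x % M)

  sumset⊆upper-model : sumset A ⊆ upper-model
  sumset⊆upper-model _ = sumset⊆ᴹY⊕Y

  lower-model⊆sumset : lower-model ⊆ sumset A
  lower-model⊆sumset x x∈ with T+L≤x , x∈R⊕Y ← T-∧⁻ (≡⇒T x∈) with p , q , p∈R , q∈Y , p+q≡x ← ∈-⊕⁻ R Y (T⇒≡ x∈R⊕Y) =
    R+Y⊆sumset (≤ᵇ⇒≤ (T + L) x T+L≤x) p∈R q∈Y p+q≡x

  lower-model-periodic : ∀ {x} → T + L ≤ x → lower-model x ≡ (R ⊕ Y) (x % M)
  lower-model-periodic T+L≤x rewrite T⇒≡ (≤⇒≤ᵇ T+L≤x) = refl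

module BuckDensity where

  open import Data.Nat as ℕ using (ℕ; suc)
  import Data.Nat.Properties as ℕ
  open import Data.Integer using (+_)
  open import Data.Rational hiding (∣_∣)
  open import Data.Rational.Properties
  open import Data.Product using (∃; _×_; _,_)
  open import Relation.Binary.PropositionalEquality
  open import Relation.Nullary using (Dec)
  open import Defs
  open Asymptotics using (Frequently; eventually⇒frequently)
  open RationalSequences
  open Densities
  open ArithmeticProgressions using (InZ⇒eventually-periodic)

  buck⇒cauchy : ∀ A → AdmitsBuckDensity A → HasAsymptoticDensity A
  buck⇒cauchy A buck = squeeze⇒cauchy λ ε 0<ε →
    let B₁ , B₂ , q₁ , q₂ , _ , _ , B₁→q₁ , B₂→q₂ , B₁⊆A , A⊆B₂ , q₂-q₁<ε = buck ε 0<ε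
    in ratio B₁ , ratio B₂ , q₁ , q₂ , B₁→q₁ , B₂→q₂ , q₂-q₁<ε , λ n → ratio-mono B₁⊆A n , ratio-mono A⊆B₂ n

  -- Taking the Buck approximations with the margin ε of a < d̲(A): a + ε ≤ d(B₂) < d(B₁) + ε.
  buck⇒dense-periodic-part : ∀ {A a} → AdmitsBuckDensity A → a <lowerDensity A →
    ∃ λ m → ∃ λ T → ∃ λ R → Residues._⊆ᴹ_beyond_ (suc m) R A T × a ≤ + Residues.∣_∣ (suc m) R / suc m
  buck⇒dense-periodic-part buck (ε , 0<ε , a+ε<ratio-eventually) =
    let B₁ , B₂ , q₁ , q₂ , B₁∈𝒵 , _ , B₁→q₁ , B₂→q₂ , B₁⊆A , A⊆B₂ , q₂-q₁<ε = buck ε 0<ε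
        m , T , periodic = InZ⇒eventually-periodic B₁∈𝒵
        R = λ r → B₁ (r ℕ.+ T ℕ.* suc m)
        q₁≡ρ = ⟶-unique {ratio B₁} B₁→q₁ (periodic-density m {B₁} {R} periodic)
        a+ε≤q₂ = frequently-below⇒≤density (eventually⇒frequently a+ε<ratio-eventually) A⊆B₂ B₂→q₂
    in m , T , R , (λ T≤x Rx → B₁⊆A _ (trans (periodic T≤x) Rx)) ,
       <⇒≤ (+-cancelʳ-< ε (≤-<-trans a+ε≤q₂ (subst (λ q → q₂ < q + ε) q₁≡ρ (p-q<ε⇒p<q+ε q₂-q₁<ε))))

  residue-model-bound : ∀ m {A R T a c b} → Residues._⊆ᴹ_beyond_ (suc m) R A T →
    (∀ r → Dec (Residues.OccursIn (suc m) A r)) → 0ℚ ≤ c → a ≤ + Residues.∣_∣ (suc m) R / suc m →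
    c <upperDensity sumset A → sumset A lowerDensity< b → a * c ≤ b * b
  residue-model-bound m {A} {R} {T} {a} {c} {b} R⊆A occurs? 0≤c a≤ρ
                      (ε₂ , 0<ε₂ , c+ε₂<ratio-often) (_ , 0<ε₃ , ratio+ε₃<b-often) = begin
    a * c   ≤⟨ *-monoʳ-≤-nonNeg c {{nonNegative 0≤c}} a≤ρ ⟩
    ρ * c   ≤⟨ *-monoˡ-≤-nonNeg ρ {{nonNegative (0≤/ ∣ρ∣ m)}} c≤τ ⟩
    ρ * τ   ≤⟨ ρτ≤σ² ⟩
    σ * σ   ≤⟨ *-monoʳ-≤-nonNeg σ {{nonNegative (0≤/ ∣σ∣ m)}} σ≤b ⟩
    b * σ   ≤⟨ *-monoˡ-≤-nonNeg b {{nonNegative (≤-trans (0≤/ ∣σ∣ m) σ≤b)}} σ≤b ⟩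
    b * b   ∎
    where
    open ≤-Reasoning
    open Residues (suc m) using (∣_∣; _⊕_)
    open ResidueModel (suc m) A R T R⊆A occurs?
    ∣ρ∣ ∣τ∣ ∣σ∣ : ℕ
    ∣ρ∣ = ∣ R ∣
    ∣τ∣ = ∣ Y ⊕ Y ∣
    ∣σ∣ = ∣ R ⊕ Y ∣
    ρ τ σ : ℚ
    ρ = + ∣ρ∣ / suc m
    τ = + ∣τ∣ / suc m
    σ = + ∣σ∣ / suc m

    c≤τ : c ≤ τ
    c≤τ = ≤-trans (<⇒≤ (p<p+ε c 0<ε₂))
            (frequently-below⇒≤density {c + ε₂} {sumset A} {upper-model} {τ} c+ε₂<ratio-often sumset⊆upper-model
              (periodic-density m {upper-model} {Y ⊕ Y} {0} λ _ → refl))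

    σ≤b : σ ≤ b
    σ≤b = frequently-above⇒density≤ {b} {lower-model} {sumset A} {σ} ratio<b-often lower-model⊆sumset
            (periodic-density m {lower-model} {R ⊕ Y} {T ℕ.+ L} lower-model-periodic)
      where
      ratio<b-often : Frequently (λ n → ratio (sumset A) n < b)
      ratio<b-often N = let n , N≤n , ratio+ε₃<b = ratio+ε₃<b-often N in
                              n , N≤n , <-trans (p<p+ε (ratio (sumset A) n) 0<ε₃) ratio+ε₃<b

    ρτ≤σ² : ρ * τ ≤ σ * σ
    ρτ≤σ² = subst₂ _≤_ (sym (/-* ∣ρ∣ m ∣τ∣ m)) (sym (/-* ∣σ∣ m ∣σ∣ m))
              (/-mono-≤ (∣ρ∣ ℕ.* ∣τ∣) (m ℕ.+ m ℕ.* suc m) (∣σ∣ ℕ.* ∣σ∣) (m ℕ.+ m ℕ.* suc m)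
                (ℕ.*-monoˡ-≤ (suc m ℕ.* suc m) (Petridis.∣X∣*∣Y⊕Y∣≤∣X⊕Y∣² (suc m) R Y)))

open import Data.Product using (_×_; _,_)
open import Data.Rational using (ℚ; _≤_; _*_; 0ℚ; _≤?_)
open import Relation.Nullary.Decidable using (decidable-stable)
open import Defs
open BuckDensity using (buck⇒cauchy; buck⇒dense-periodic-part; residue-model-bound)

corollary6p9 : (A : Subset) → AdmitsBuckDensity A →
    HasAsymptoticDensity A ×
    ((a c b : ℚ) → 0ℚ ≤ a → 0ℚ ≤ c →
      a <lowerDensity A → c <upperDensity sumset A → sumset A lowerDensity< b →
      a * c ≤ b * b)
corollary6p9 A buck = buck⇒cauchy A buck , λ a c b _ 0≤c a<d̲A c<d̄[A+A] d̲[A+A]<b →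
  let m , T , R , R⊆A , a≤ρ = buck⇒dense-periodic-part {A} {a} buck a<d̲A
  in decidable-stable (a * c ≤? b * b) λ a*c≰b*b →
       Residues.¬¬-occurs? (suc m) A λ occurs? →
         a*c≰b*b (residue-model-bound m {a = a} R⊆A occurs? 0≤c a≤ρ c<d̄[A+A] d̲[A+A]<b)
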